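{- For every integer $m\geq 1$, $\mathcal{T}_{m}\#\mathcal{P}_1$ is $\mathcal{D}$-equivalent to $\mathcal{P}_{2m+1}$.
   Context: A $3$-regular colored graph is a loopless $3$-regular multigraph with a proper edge-coloring $\gamma:E\to\{0,1,2\}$, considered up to color-preserving isomorphism. Connected sum: for disjoint colored graphs $\Gamma^1,\Gamma^2$ and vertices $v_1\in\Gamma^1,v_2\in\Gamma^2$, $\Gamma^1\#_{v_1v_2}\Gamma^2$ is obtained from $(\Gamma^1-v_1)\sqcup(\Gamma^2-v_2)$ by joining, for each color $j$, the color-$j$ neighbours of $v_1$ and $v_2$ by a new color-$j$ edge. Bipartite graphs carry a fixed black/white bipartition; $\Gamma^1\#\Gamma^2$ means a connected sum at arbitrary vertices, except that if both graphs are bipartite the two vertices must have different colors (types). Interchanging the vertices of connected sums: replacing $\Gamma^1\#_{uv}\Gamma^2$ by $\Gamma^1\#_{u'v'}\Gamma^2$, $(u',v')\neq(u,v)$ (different types if both bipartite). Simple cut: if $G,H$ are disjoint $2$-regular colored graphs with colors $0,1$, $V(G)\cup V(H)=V(\Gamma)\cup\{z_1,z_2\}$, $z_1\in G$, $z_2\in H$, and $\Gamma_{\{0,1\}}=G\#_{z_1z_2}H$ (where $\Gamma_{\{0,1\}}$ is the subgraph of edges of colors $0,1$), let $\bar\Gamma$ have $\bar\Gamma_{\{0,1\}}=G\sqcup H$, a color-$2$ edge $z_1z_2$, and the same color-$2$ edges as $\Gamma$ among vertices other than $z_1,z_2$. $\Gamma'$ is obtained from $\Gamma$ by a simple cut-and-glue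 move if some $\bar\Gamma$ arises by a simple cut (color $2$) both from $\Gamma$ with a pair $(z_1,z_2)$ and from $\Gamma'$ with a pair $(w_1,w_2)$. Two graphs are $\mathcal{D}$-equivalent if related by a finite sequence of simple cut-and-glue moves and interchanges of vertices of connected sums. $\mathcal{P}_1$ is $K_4$ with a proper $3$-edge-coloring. $\mathcal{T}_1$ is $K_{3,3}$ on $v_1,\dots,v_6$ with color-$0$ edges $v_1v_2,v_3v_4,v_5v_6$, color-$1$ edges $v_2v_3,v_4v_5,v_6v_1$, color-$2$ edges $v_1v_4,v_2v_5,v_3v_6$. $\mathcal{P}_m$ (resp. $\mathcal{T}_m$) denotes a connected sum of $m$ copies of $\mathcal{P}_1$ (resp. $\mathcal{T}_1$). -}

module Defs where

open import Data.Nat using (ℕ; zero; suc)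
open import Data.Fin using (Fin; zero; suc)
open import Data.Bool using (Bool; true; false)
open import Data.Product using (Σ; ∃; _×_; _,_; proj₁; Σ-syntax)
open import Data.Sum using (_⊎_)
open import Data.Empty using (⊥)
open import Relation.Nullary using (¬_)
open import Relation.Binary.PropositionalEquality using (_≡_; _≢_; refl)
open import Relation.Binary.Construct.Closure.Equivalence using (EqClosure)

-- Vertex set Fin n; for each colour c, σ c is the fixed-point-free
-- involution sending a vertex to its colour-c neighbour.  This is exactly
-- a loopless 3-regular multigraph with a proper edge-colouring in {0,1,2}.

Color : Set
Color = Fin 3

c0 c1 c2 : Color
c0 = zero
c1 = suc zero
c2 = suc (suc zero)

record CG : Set where
  field
    n        : ℕ
    σ        : Color → Fin n → Fin n
    invol    : ∀ c v → σ c (σ c v) ≡ v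
    loopless : ∀ c v → σ c v ≢ v
open CG public

record _≅_ (Γ Δ : CG) : Set where
  field
    to      : Fin (n Γ) → Fin (n Δ)
    from    : Fin (n Δ) → Fin (n Γ)
    from-to : ∀ v → from (to v) ≡ v
    to-from : ∀ w → to (from w) ≡ w
    hom     : ∀ c v → to (σ Γ c v) ≡ σ Δ c (to v)

Bipartition : CG → Set
Bipartition Γ = Σ (Fin (n Γ) → Bool) λ κ → ∀ c v → κ (σ Γ c v) ≢ κ v

Bipartite : CG → Set
Bipartite Γ = Bipartition Γ

-- Γ is (isomorphic to) the connected sum Γ₁ #_{v₁v₂} Γ₂.
-- ι₁, ι₂ embed the vertices of Γ₁ - v₁ and Γ₂ - v₂ into Γ
-- (jointly bijectively); old edges are kept, and for each colour c the
-- colour-c neighbours of v₁ and v₂ are joined by a colour-c edge.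

record IsConnSumAt (Γ Γ₁ Γ₂ : CG) (v₁ : Fin (n Γ₁)) (v₂ : Fin (n Γ₂)) : Set where
  field
    ι₁    : Fin (n Γ₁) → Fin (n Γ)
    ι₂    : Fin (n Γ₂) → Fin (n Γ)
    inj₁  : ∀ a b → a ≢ v₁ → b ≢ v₁ → ι₁ a ≡ ι₁ b → a ≡ b
    inj₂  : ∀ a b → a ≢ v₂ → b ≢ v₂ → ι₂ a ≡ ι₂ b → a ≡ b
    disj  : ∀ a b → a ≢ v₁ → b ≢ v₂ → ι₁ a ≢ ι₂ b
    cover : ∀ x → (Σ[ a ∈ Fin (n Γ₁) ] (a ≢ v₁ × ι₁ a ≡ x))
                ⊎ (Σ[ b ∈ Fin (n Γ₂) ] (b ≢ v₂ × ι₂ b ≡ x))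
    edge₁ : ∀ c a → a ≢ v₁ → σ Γ₁ c a ≢ v₁ → σ Γ c (ι₁ a) ≡ ι₁ (σ Γ₁ c a)
    edge₂ : ∀ c b → b ≢ v₂ → σ Γ₂ c b ≢ v₂ → σ Γ c (ι₂ b) ≡ ι₂ (σ Γ₂ c b)
    new   : ∀ c → σ Γ c (ι₁ (σ Γ₁ c v₁)) ≡ ι₂ (σ Γ₂ c v₂)

TypeOK : (Γ₁ Γ₂ : CG) → Fin (n Γ₁) → Fin (n Γ₂) → Set
TypeOK Γ₁ Γ₂ v₁ v₂ =
  ¬ Bipartite Γ₁ ⊎ ¬ Bipartite Γ₂ ⊎
  (Σ[ κ₁ ∈ Bipartition Γ₁ ] Σ[ κ₂ ∈ Bipartition Γ₂ ] proj₁ κ₁ v₁ ≢ proj₁ κ₂ v₂)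

ConnSum : CG → CG → CG → Set
ConnSum Γ Γ₁ Γ₂ =
  Σ[ v₁ ∈ Fin (n Γ₁) ] Σ[ v₂ ∈ Fin (n Γ₂) ] (IsConnSumAt Γ Γ₁ Γ₂ v₁ v₂ × TypeOK Γ₁ Γ₂ v₁ v₂)

Interchange : CG → CG → Set
Interchange Γ Γ' =
  Σ[ Γ₁ ∈ CG ] Σ[ Γ₂ ∈ CG ]
  Σ[ u ∈ Fin (n Γ₁) ] Σ[ v ∈ Fin (n Γ₂) ] Σ[ u' ∈ Fin (n Γ₁) ] Σ[ v' ∈ Fin (n Γ₂) ]
    ( ¬ (u ≡ u' × v ≡ v')
    × IsConnSumAt Γ Γ₁ Γ₂ u v
    × IsConnSumAt Γ' Γ₁ Γ₂ u' v'
    × ( ¬ Bipartite Γ₁ ⊎ ¬ Bipartite Γ₂ ⊎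
        (Σ[ κ₁ ∈ Bipartition Γ₁ ] Σ[ κ₂ ∈ Bipartition Γ₂ ]
           (proj₁ κ₁ u ≢ proj₁ κ₂ v × proj₁ κ₁ u' ≢ proj₁ κ₂ v'))))

-- Simple cut (colour 2): Γ̄ arises from Γ by a simple cut with the pair
-- (z₁, z₂) of vertices of Γ̄.  ι identifies V(Γ) with V(Γ̄) ∖ {z₁,z₂};
-- Γ̄_{0,1} = G ⊔ H with z₁ ∈ G, z₂ ∈ H (given by `side`), and
-- Γ_{0,1} = G #_{z₁z₂} H; colour-2 edges of Γ are those of Γ̄ on V(Γ), and
-- z₁z₂ is a colour-2 edge of Γ̄.

record SimpleCut (Γ Γ̄ : CG) (z₁ z₂ : Fin (n Γ̄)) : Set where
  field
    z₁≢z₂    : z₁ ≢ z₂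
    z-edge   : σ Γ̄ c2 z₁ ≡ z₂
    ι        : Fin (n Γ) → Fin (n Γ̄)
    ι-inj    : ∀ a b → ι a ≡ ι b → a ≡ b
    ι≢z₁     : ∀ a → ι a ≢ z₁
    ι≢z₂     : ∀ a → ι a ≢ z₂
    ι-cover  : ∀ x → x ≢ z₁ → x ≢ z₂ → Σ[ a ∈ Fin (n Γ) ] ι a ≡ x
    col2     : ∀ a → σ Γ̄ c2 (ι a) ≡ ι (σ Γ c2 a)
    col01    : ∀ c → c ≢ c2 → ∀ a →
                 (σ Γ̄ c (ι a) ≢ z₁ → σ Γ̄ c (ι a) ≢ z₂ → σ Γ̄ c (ι a) ≡ ι (σ Γ c a))
               × (σ Γ̄ c (ι a) ≡ z₁ → ι (σ Γ c a) ≡ σ Γ̄ c z₂)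
               × (σ Γ̄ c (ι a) ≡ z₂ → ι (σ Γ c a) ≡ σ Γ̄ c z₁)
    side     : Fin (n Γ̄) → Bool
    side-z₁  : side z₁ ≡ false
    side-z₂  : side z₂ ≡ true
    side-01  : ∀ c → c ≢ c2 → ∀ x → side (σ Γ̄ c x) ≡ side x

CutAndGlue : CG → CG → Set
CutAndGlue Γ Γ' =
  Σ[ Γ̄ ∈ CG ] Σ[ z₁ ∈ Fin (n Γ̄) ] Σ[ z₂ ∈ Fin (n Γ̄) ]
  Σ[ w₁ ∈ Fin (n Γ̄) ] Σ[ w₂ ∈ Fin (n Γ̄) ]
    (SimpleCut Γ Γ̄ z₁ z₂ × SimpleCut Γ' Γ̄ w₁ w₂)

-- one elementary step (isomorphism accounts for "up to isomorphism")
Move : CG → CG → Set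
Move Γ Γ' = (Γ ≅ Γ') ⊎ CutAndGlue Γ Γ' ⊎ Interchange Γ Γ'

_∼𝒟_ : CG → CG → Set
_∼𝒟_ = EqClosure Move

-- 𝒫₁ = K₄ (vertices 0..3): colour 0 {01,23}, colour 1 {02,13}, colour 2 {03,12}

private
  pattern f0 = zero
  pattern f1 = suc zero
  pattern f2 = suc (suc zero)
  pattern f3 = suc (suc (suc zero))
  pattern f4 = suc (suc (suc (suc zero)))
  pattern f5 = suc (suc (suc (suc (suc zero))))

σP : Color → Fin 4 → Fin 4
σP f0 f0 = f1
σP f0 f1 = f0
σP f0 f2 = f3
σP f0 f3 = f2
σP f1 f0 = f2
σP f1 f1 = f3
σP f1 f2 = f0
σP f1 f3 = f1
σP f2 f0 = f3
σP f2 f1 = f2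
σP f2 f2 = f1
σP f2 f3 = f0

σP-invol : ∀ c v → σP c (σP c v) ≡ v
σP-invol f0 f0 = refl
σP-invol f0 f1 = refl
σP-invol f0 f2 = refl
σP-invol f0 f3 = refl
σP-invol f1 f0 = refl
σP-invol f1 f1 = refl
σP-invol f1 f2 = refl
σP-invol f1 f3 = refl
σP-invol f2 f0 = refl
σP-invol f2 f1 = refl
σP-invol f2 f2 = refl
σP-invol f2 f3 = refl

σP-loopless : ∀ c v → σP c v ≢ v
σP-loopless f0 f0 ()
σP-loopless f0 f1 ()
σP-loopless f0 f2 ()
σP-loopless f0 f3 ()
σP-loopless f1 f0 ()
σP-loopless f1 f1 ()
σP-loopless f1 f2 ()
σP-loopless f1 f3 ()
σP-loopless f2 f0 ()
σP-loopless f2 f1 ()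
σP-loopless f2 f2 ()
σP-loopless f2 f3 ()

𝒫₁ : CG
𝒫₁ = record { n = 4 ; σ = σP ; invol = σP-invol ; loopless = σP-loopless }

-- 𝒯₁ = K_{3,3} on v₁..v₆ (here vertices 0..5, vᵢ ↦ i-1):
-- colour 0 {v₁v₂,v₃v₄,v₅v₆}, colour 1 {v₂v₃,v₄v₅,v₆v₁},
-- colour 2 {v₁v₄,v₂v₅,v₃v₆}

σT : Color → Fin 6 → Fin 6
σT f0 f0 = f1
σT f0 f1 = f0
σT f0 f2 = f3
σT f0 f3 = f2
σT f0 f4 = f5
σT f0 f5 = f4
σT f1 f0 = f5
σT f1 f1 = f2
σT f1 f2 = f1
σT f1 f3 = f4
σT f1 f4 = f3
σT f1 f5 = f0
σT f2 f0 = f3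
σT f2 f1 = f4
σT f2 f2 = f5
σT f2 f3 = f0
σT f2 f4 = f1
σT f2 f5 = f2

σT-invol : ∀ c v → σT c (σT c v) ≡ v
σT-invol f0 f0 = refl
σT-invol f0 f1 = refl
σT-invol f0 f2 = refl
σT-invol f0 f3 = refl
σT-invol f0 f4 = refl
σT-invol f0 f5 = refl
σT-invol f1 f0 = refl
σT-invol f1 f1 = refl
σT-invol f1 f2 = refl
σT-invol f1 f3 = refl
σT-invol f1 f4 = refl
σT-invol f1 f5 = refl
σT-invol f2 f0 = refl
σT-invol f2 f1 = refl
σT-invol f2 f2 = refl
σT-invol f2 f3 = refl
σT-invol f2 f4 = refl
σT-invol f2 f5 = refl

σT-loopless : ∀ c v → σT c v ≢ v
σT-loopless f0 f0 ()
σT-loopless f0 f1 ()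
σT-loopless f0 f2 ()
σT-loopless f0 f3 ()
σT-loopless f0 f4 ()
σT-loopless f0 f5 ()
σT-loopless f1 f0 ()
σT-loopless f1 f1 ()
σT-loopless f1 f2 ()
σT-loopless f1 f3 ()
σT-loopless f1 f4 ()
σT-loopless f1 f5 ()
σT-loopless f2 f0 ()
σT-loopless f2 f1 ()
σT-loopless f2 f2 ()
σT-loopless f2 f3 ()
σT-loopless f2 f4 ()
σT-loopless f2 f5 ()

𝒯₁ : CG
𝒯₁ = record { n = 6 ; σ = σT ; invol = σT-invol ; loopless = σT-loopless }

-- "Γ is a connected sum of m copies of Δ" (m ≥ 1).  Any bracketing of an
-- iterated connected sum can be rewritten as (…(Δ # Δ) # …) # Δ, so we
-- use the left-iterated form.

IsSumOf : CG → ℕ → CG → Set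
IsSumOf Δ zero          Γ = ⊥
IsSumOf Δ (suc zero)    Γ = Γ ≅ Δ
IsSumOf Δ (suc (suc m)) Γ = Σ[ X ∈ CG ] (IsSumOf Δ (suc m) X × ConnSum Γ X Δ)

Is𝒫 : ℕ → CG → Set
Is𝒫 = IsSumOf 𝒫₁

Is𝒯 : ℕ → CG → Set
Is𝒯 = IsSumOf 𝒯₁

{-# OPTIONS --safe #-}
-- 𝒯₁ # 𝒫₁ and 𝒫₃ have a common simple cut (a 10-vertex graph), so they differ by one cut-and-glue
-- move; and a simple cut of a summand, taken away from the summing vertex, is a simple cut of the
-- whole connected sum, so the move can be made inside any sum.  As 𝒫₁ is not bipartite,
-- interchanges make the attaching vertices of a sum with 𝒫₁ or 𝒫ₖ irrelevant.  Hence every 𝒫ₖ # X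
-- is 𝒟-equivalent to a fixed chain of k copies of 𝒫₁ hanging off X, and in 𝒯ₘ # X with
-- X = 𝒫₁ # X′ one copy of 𝒯₁ can be moved next to that 𝒫₁ and, together with it, traded for 𝒫₃.
-- Induction on m gives 𝒯ₘ # X ∼ (chain of 2m copies on X); for X = 𝒫₁ = 𝒫₁ # dipole this is
-- 𝒯ₘ # 𝒫₁ ∼ 𝒫₂ₘ # 𝒫₁ = 𝒫₂ₘ₊₁.

module Submission where

open import Defs
open import Data.Bool using (Bool; true; false)
import Data.Bool.Properties as Bool
open import Data.Empty using (⊥; ⊥-elim)
open import Data.Fin using (Fin; punchIn; punchOut; splitAt; _↑ˡ_; _↑ʳ_; opposite; #_)
open import Data.Fin.Patterns using (0F; 1F; 2F; 3F)
open import Data.Fin.Properties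
  using (_≟_; all?; any?; punchIn-punchOut; punchOut-punchIn; punchInᵢ≢i; punchOut-cong;
         punchOut-injective; splitAt-↑ˡ; splitAt-↑ʳ; splitAt⁻¹-↑ˡ; splitAt⁻¹-↑ʳ; ↑ˡ-injective; ↑ʳ-injective)
open import Data.Nat using (ℕ; zero; suc; _+_; _*_; _≤_)
open import Data.Nat.Properties using (+-comm; *-suc)
open import Data.Product using (_×_; _,_; proj₁; proj₂; Σ-syntax)
open import Data.Sum using (_⊎_; inj₁; inj₂; [_,_]′)
open import Data.Vec using (Vec; _∷_; []; lookup)
open import Function using (_∘_)
open import Relation.Nullary using (¬_; Dec; yes; no; ¬?)
open import Relation.Nullary.Decidable using (True; toWitness; from-yes; _×-dec_; _→-dec_)
open import Relation.Binary.PropositionalEquality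
  using (_≡_; _≢_; refl; sym; trans; cong; subst; ≢-sym; module ≡-Reasoning)
import Relation.Binary.Construct.Closure.Equivalence as EqClosure
import Relation.Binary.Reasoning.Setoid as SetoidReasoning

-- Connected sums

punctured : ∀ {n} → Fin n → ℕ
punctured {suc k} _ = k

include : ∀ {n} (a : Fin n) → Fin (punctured a) → Fin n
include {suc k} a = punchIn a

exclude : ∀ {n} (a x : Fin n) → x ≢ a → Fin (punctured a)
exclude {suc k} a x x≢a = punchOut (≢-sym x≢a)

include≢ : ∀ {n} (a : Fin n) i → include a i ≢ a
include≢ {suc k} = punchInᵢ≢i

include-exclude : ∀ {n} (a x : Fin n) (x≢a : x ≢ a) → include a (exclude a x x≢a) ≡ x
include-exclude {suc k} a x x≢a = punchIn-punchOut (≢-sym x≢a)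

exclude-include : ∀ {n} (a : Fin n) i (p : include a i ≢ a) → exclude a (include a i) p ≡ i
exclude-include {suc k} a i p = trans (punchOut-cong a refl) (punchOut-punchIn a)

exclude-cong : ∀ {n} (a : Fin n) {x y} (p : x ≢ a) (q : y ≢ a) → x ≡ y → exclude a x p ≡ exclude a y q
exclude-cong {suc k} a p q = punchOut-cong a

exclude-injective : ∀ {n} (a : Fin n) {x y} (p : x ≢ a) (q : y ≢ a) →
                    exclude a x p ≡ exclude a y q → x ≡ y
exclude-injective {suc k} a p q = punchOut-injective (≢-sym p) (≢-sym q)

module ConnectedSum (A : CG) (a : Fin (n A)) (B : CG) (b : Fin (n B)) where
  open ≡-Reasoning

  size : ℕ
  size = punctured a + punctured b

  left : Fin (punctured a) → Fin size
  left i = i ↑ˡ punctured b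

  right : Fin (punctured b) → Fin size
  right j = punctured a ↑ʳ j

  left≢right : ∀ i j → left i ≢ right j
  left≢right i j e with trans (sym (splitAt-↑ˡ (punctured a) i (punctured b)))
                        (trans (cong (splitAt (punctured a)) e) (splitAt-↑ʳ (punctured a) (punctured b) j))
  ... | ()

  -- ι₁ a and ι₂ b are junk values, chosen only to make ι₁ and ι₂ total.
  ι₁ : Fin (n A) → Fin size
  ι₁ α with α ≟ a
  ... | yes _   = left (exclude a (σ A c0 a) (loopless A c0 a))
  ... | no α≢a = left (exclude a α α≢a)

  ι₂ : Fin (n B) → Fin size
  ι₂ β with β ≟ b
  ... | yes _   = right (exclude b (σ B c0 b) (loopless B c0 b))
  ... | no β≢b = right (exclude b β β≢b)

  ι₁-≢ : ∀ α (α≢a : α ≢ a) → ι₁ α ≡ left (exclude a α α≢a)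
  ι₁-≢ α α≢a with α ≟ a
  ... | yes α≡a = ⊥-elim (α≢a α≡a)
  ... | no α≢a′ = cong left (exclude-cong a α≢a′ α≢a refl)

  ι₂-≢ : ∀ β (β≢b : β ≢ b) → ι₂ β ≡ right (exclude b β β≢b)
  ι₂-≢ β β≢b with β ≟ b
  ... | yes β≡b = ⊥-elim (β≢b β≡b)
  ... | no β≢b′ = cong right (exclude-cong b β≢b′ β≢b refl)

  ι₁-injective : ∀ {α α′} → α ≢ a → α′ ≢ a → ι₁ α ≡ ι₁ α′ → α ≡ α′
  ι₁-injective {α} {α′} p q e =
    exclude-injective a p q (↑ˡ-injective (punctured b) _ _ (trans (sym (ι₁-≢ α p)) (trans e (ι₁-≢ α′ q))))

  ι₂-injective : ∀ {β β′} → β ≢ b → β′ ≢ b → ι₂ β ≡ ι₂ β′ → β ≡ β′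
  ι₂-injective {β} {β′} p q e =
    exclude-injective b p q (↑ʳ-injective (punctured a) _ _ (trans (sym (ι₂-≢ β p)) (trans e (ι₂-≢ β′ q))))

  ι₁≢ι₂ : ∀ α β → α ≢ a → β ≢ b → ι₁ α ≢ ι₂ β
  ι₁≢ι₂ α β p q e = left≢right _ _ (trans (sym (ι₁-≢ α p)) (trans e (ι₂-≢ β q)))

  cover : ∀ v → (Σ[ α ∈ Fin (n A) ] (α ≢ a × ι₁ α ≡ v)) ⊎ (Σ[ β ∈ Fin (n B) ] (β ≢ b × ι₂ β ≡ v))
  cover v with splitAt (punctured a) v in eq
  ... | inj₁ i = inj₁ (include a i , include≢ a i ,
                       trans (ι₁-≢ _ (include≢ a i)) (trans (cong left (exclude-include a i _)) (splitAt⁻¹-↑ˡ eq)))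
  ... | inj₂ j = inj₂ (include b j , include≢ b j ,
                       trans (ι₂-≢ _ (include≢ b j)) (trans (cong right (exclude-include b j _)) (splitAt⁻¹-↑ʳ eq)))

  -- The image of α ∈ A reached along colour c: edges into a are redirected to the colour-c neighbour of b.
  redirect₁ : Color → Fin (n A) → Fin size
  redirect₁ c α with α ≟ a
  ... | yes _   = ι₂ (σ B c b)
  ... | no α≢a = left (exclude a α α≢a)

  redirect₂ : Color → Fin (n B) → Fin size
  redirect₂ c β with β ≟ b
  ... | yes _   = ι₁ (σ A c a)
  ... | no β≢b = right (exclude b β β≢b)

  redirect₁-≡ : ∀ c {α} → α ≡ a → redirect₁ c α ≡ ι₂ (σ B c b)
  redirect₁-≡ c {α} α≡a with α ≟ a
  ... | yes _   = refl
  ... | no α≢a = ⊥-elim (α≢a α≡a)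

  redirect₁-≢ : ∀ c {α} → α ≢ a → redirect₁ c α ≡ ι₁ α
  redirect₁-≢ c {α} α≢a with α ≟ a
  ... | yes α≡a = ⊥-elim (α≢a α≡a)
  ... | no _    = refl

  redirect₂-≡ : ∀ c {β} → β ≡ b → redirect₂ c β ≡ ι₁ (σ A c a)
  redirect₂-≡ c {β} β≡b with β ≟ b
  ... | yes _   = refl
  ... | no β≢b = ⊥-elim (β≢b β≡b)

  redirect₂-≢ : ∀ c {β} → β ≢ b → redirect₂ c β ≡ ι₂ β
  redirect₂-≢ c {β} β≢b with β ≟ b
  ... | yes β≡b = ⊥-elim (β≢b β≡b)
  ... | no _    = refl

  σ# : Color → Fin size → Fin size
  σ# c v with splitAt (punctured a) v
  ... | inj₁ i = redirect₁ c (σ A c (include a i))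
  ... | inj₂ j = redirect₂ c (σ B c (include b j))

  σ#-ι₁ : ∀ c α → α ≢ a → σ# c (ι₁ α) ≡ redirect₁ c (σ A c α)
  σ#-ι₁ c α α≢a
    rewrite ι₁-≢ α α≢a | splitAt-↑ˡ (punctured a) (exclude a α α≢a) (punctured b) | include-exclude a α α≢a = refl

  σ#-ι₂ : ∀ c β → β ≢ b → σ# c (ι₂ β) ≡ redirect₂ c (σ B c β)
  σ#-ι₂ c β β≢b
    rewrite ι₂-≢ β β≢b | splitAt-↑ʳ (punctured a) (punctured b) (exclude b β β≢b) | include-exclude b β β≢b = refl

  σ#-invol-ι₁ : ∀ c α → α ≢ a → σ# c (σ# c (ι₁ α)) ≡ ι₁ α
  σ#-invol-ι₁ c α α≢a with σ A c α ≟ a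
  ... | yes σα≡a = begin
    σ# c (σ# c (ι₁ α))             ≡⟨ cong (σ# c) (trans (σ#-ι₁ c α α≢a) (redirect₁-≡ c σα≡a)) ⟩
    σ# c (ι₂ (σ B c b))            ≡⟨ σ#-ι₂ c _ (loopless B c b) ⟩
    redirect₂ c (σ B c (σ B c b))  ≡⟨ redirect₂-≡ c (invol B c b) ⟩
    ι₁ (σ A c a)                   ≡⟨ cong (ι₁ ∘ σ A c) (sym σα≡a) ⟩
    ι₁ (σ A c (σ A c α))           ≡⟨ cong ι₁ (invol A c α) ⟩
    ι₁ α                           ∎
  ... | no σα≢a = begin
    σ# c (σ# c (ι₁ α))             ≡⟨ cong (σ# c) (trans (σ#-ι₁ c α α≢a) (redirect₁-≢ c σα≢a)) ⟩
    σ# c (ι₁ (σ A c α))            ≡⟨ σ#-ι₁ c _ σα≢a ⟩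
    redirect₁ c (σ A c (σ A c α))  ≡⟨ cong (redirect₁ c) (invol A c α) ⟩
    redirect₁ c α                  ≡⟨ redirect₁-≢ c α≢a ⟩
    ι₁ α                           ∎

  σ#-invol-ι₂ : ∀ c β → β ≢ b → σ# c (σ# c (ι₂ β)) ≡ ι₂ β
  σ#-invol-ι₂ c β β≢b with σ B c β ≟ b
  ... | yes σβ≡b = begin
    σ# c (σ# c (ι₂ β))             ≡⟨ cong (σ# c) (trans (σ#-ι₂ c β β≢b) (redirect₂-≡ c σβ≡b)) ⟩
    σ# c (ι₁ (σ A c a))            ≡⟨ σ#-ι₁ c _ (loopless A c a) ⟩
    redirect₁ c (σ A c (σ A c a))  ≡⟨ redirect₁-≡ c (invol A c a) ⟩
    ι₂ (σ B c b)                   ≡⟨ cong (ι₂ ∘ σ B c) (sym σβ≡b) ⟩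
    ι₂ (σ B c (σ B c β))           ≡⟨ cong ι₂ (invol B c β) ⟩
    ι₂ β                           ∎
  ... | no σβ≢b = begin
    σ# c (σ# c (ι₂ β))             ≡⟨ cong (σ# c) (trans (σ#-ι₂ c β β≢b) (redirect₂-≢ c σβ≢b)) ⟩
    σ# c (ι₂ (σ B c β))            ≡⟨ σ#-ι₂ c _ σβ≢b ⟩
    redirect₂ c (σ B c (σ B c β))  ≡⟨ cong (redirect₂ c) (invol B c β) ⟩
    redirect₂ c β                  ≡⟨ redirect₂-≢ c β≢b ⟩
    ι₂ β                           ∎

  σ#-invol : ∀ c v → σ# c (σ# c v) ≡ v
  σ#-invol c v with cover v
  ... | inj₁ (α , α≢a , refl) = σ#-invol-ι₁ c α α≢a
  ... | inj₂ (β , β≢b , refl) = σ#-invol-ι₂ c β β≢b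

  σ#-loopless-ι₁ : ∀ c α → α ≢ a → σ# c (ι₁ α) ≢ ι₁ α
  σ#-loopless-ι₁ c α α≢a e with σ A c α ≟ a
  ... | yes σα≡a = ι₁≢ι₂ α _ α≢a (loopless B c b)
                     (sym (trans (sym (trans (σ#-ι₁ c α α≢a) (redirect₁-≡ c σα≡a))) e))
  ... | no σα≢a = loopless A c α
                    (ι₁-injective σα≢a α≢a (trans (sym (trans (σ#-ι₁ c α α≢a) (redirect₁-≢ c σα≢a))) e))

  σ#-loopless-ι₂ : ∀ c β → β ≢ b → σ# c (ι₂ β) ≢ ι₂ β
  σ#-loopless-ι₂ c β β≢b e with σ B c β ≟ b
  ... | yes σβ≡b = ι₁≢ι₂ _ β (loopless A c a) β≢b
                     (trans (sym (trans (σ#-ι₂ c β β≢b) (redirect₂-≡ c σβ≡b))) e)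
  ... | no σβ≢b = loopless B c β
                    (ι₂-injective σβ≢b β≢b (trans (sym (trans (σ#-ι₂ c β β≢b) (redirect₂-≢ c σβ≢b))) e))

  σ#-loopless : ∀ c v → σ# c v ≢ v
  σ#-loopless c v with cover v
  ... | inj₁ (α , α≢a , refl) = σ#-loopless-ι₁ c α α≢a
  ... | inj₂ (β , β≢b , refl) = σ#-loopless-ι₂ c β β≢b

connSum : (A : CG) → Fin (n A) → (B : CG) → Fin (n B) → CG
connSum A a B b = record { n = size ; σ = σ# ; invol = σ#-invol ; loopless = σ#-loopless }
  where open ConnectedSum A a B b

infixl 30 connSum
syntax connSum A a B b = A #⟨ a ∣ b ⟩ B

#-isConnSumAt : ∀ A a B b → IsConnSumAt (A #⟨ a ∣ b ⟩ B) A B a b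
#-isConnSumAt A a B b = record
  { ι₁ = ι₁ ; ι₂ = ι₂ ; inj₁ = λ _ _ → ι₁-injective ; inj₂ = λ _ _ → ι₂-injective ; disj = ι₁≢ι₂
  ; cover = cover
  ; edge₁ = λ c α α≢a σα≢a → trans (σ#-ι₁ c α α≢a) (redirect₁-≢ c σα≢a)
  ; edge₂ = λ c β β≢b σβ≢b → trans (σ#-ι₂ c β β≢b) (redirect₂-≢ c σβ≢b)
  ; new = λ c → trans (σ#-ι₁ c _ (loopless A c a)) (redirect₁-≡ c (invol A c a)) }
  where open ConnectedSum A a B b

module Summands {Γ A B : CG} {a : Fin (n A)} {b : Fin (n B)} (S : IsConnSumAt Γ A B a b) where
  open IsConnSumAt S using (ι₁; ι₂; cover; edge₁; edge₂; new)
  open IsConnSumAt S using () renaming (inj₁ to ι₁-injective; inj₂ to ι₂-injective; disj to ι₁≢ι₂)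

  σ-ι₁-glued : ∀ c α → σ A c α ≡ a → σ Γ c (ι₁ α) ≡ ι₂ (σ B c b)
  σ-ι₁-glued c α σα≡a =
    subst (λ α′ → σ Γ c (ι₁ α′) ≡ ι₂ (σ B c b)) (trans (cong (σ A c) (sym σα≡a)) (invol A c α)) (new c)

  σ-ι₂-glued : ∀ c β → σ B c β ≡ b → σ Γ c (ι₂ β) ≡ ι₁ (σ A c a)
  σ-ι₂-glued c β σβ≡b =
    subst (λ β′ → σ Γ c (ι₂ β′) ≡ ι₁ (σ A c a)) (trans (cong (σ B c) (sym σβ≡b)) (invol B c β))
          (trans (cong (σ Γ c) (sym (new c))) (invol Γ c _))

  σ-ι₁-cases : ∀ c α → α ≢ a →
               (σ A c α ≡ a × σ Γ c (ι₁ α) ≡ ι₂ (σ B c b)) ⊎ (σ A c α ≢ a × σ Γ c (ι₁ α) ≡ ι₁ (σ A c α))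
  σ-ι₁-cases c α α≢a with σ A c α ≟ a
  ... | yes σα≡a = inj₁ (σα≡a , σ-ι₁-glued c α σα≡a)
  ... | no σα≢a  = inj₂ (σα≢a , edge₁ c α α≢a σα≢a)

  σ-ι₂-cases : ∀ c β → β ≢ b →
               (σ B c β ≡ b × σ Γ c (ι₂ β) ≡ ι₁ (σ A c a)) ⊎ (σ B c β ≢ b × σ Γ c (ι₂ β) ≡ ι₂ (σ B c β))
  σ-ι₂-cases c β β≢b with σ B c β ≟ b
  ... | yes σβ≡b = inj₁ (σβ≡b , σ-ι₂-glued c β σβ≡b)
  ... | no σβ≢b  = inj₂ (σβ≢b , edge₂ c β β≢b σβ≢b)

  vertex-rec : ∀ {X : Set} → (Fin (n A) → X) → (Fin (n B) → X) → Fin (n Γ) → X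
  vertex-rec f g v with cover v
  ... | inj₁ (α , _) = f α
  ... | inj₂ (β , _) = g β

  vertex-rec-ι₁ : ∀ {X : Set} (f : Fin (n A) → X) (g : Fin (n B) → X) α → α ≢ a → vertex-rec f g (ι₁ α) ≡ f α
  vertex-rec-ι₁ f g α α≢a with cover (ι₁ α)
  ... | inj₁ (α′ , α′≢a , e) = cong f (ι₁-injective α′ α α′≢a α≢a e)
  ... | inj₂ (β , β≢b , e)   = ⊥-elim (ι₁≢ι₂ α β α≢a β≢b (sym e))

  vertex-rec-ι₂ : ∀ {X : Set} (f : Fin (n A) → X) (g : Fin (n B) → X) β → β ≢ b → vertex-rec f g (ι₂ β) ≡ g β
  vertex-rec-ι₂ f g β β≢b with cover (ι₂ β)
  ... | inj₁ (α , α≢a , e)   = ⊥-elim (ι₁≢ι₂ α β α≢a β≢b e)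
  ... | inj₂ (β′ , β′≢b , e) = cong g (ι₂-injective β′ β β′≢b β≢b e)

  vertex-ind : ∀ (P : Fin (n Γ) → Set) → (∀ α → α ≢ a → P (ι₁ α)) → (∀ β → β ≢ b → P (ι₂ β)) → ∀ v → P v
  vertex-ind P f g v with cover v
  ... | inj₁ (α , α≢a , refl) = f α α≢a
  ... | inj₂ (β , β≢b , refl) = g β β≢b

≅-refl : ∀ {Γ} → Γ ≅ Γ
≅-refl = record { to = λ v → v ; from = λ v → v ; from-to = λ _ → refl ; to-from = λ _ → refl ; hom = λ _ _ → refl }

≅-sym : ∀ {Γ Δ} → Γ ≅ Δ → Δ ≅ Γ
≅-sym {Γ} {Δ} φ = record { to = from ; from = to ; from-to = to-from ; to-from = from-to ; hom = from-hom }
  where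
  open _≅_ φ
  from-hom : ∀ c w → from (σ Δ c w) ≡ σ Γ c (from w)
  from-hom c w = trans (cong (λ w′ → from (σ Δ c w′)) (sym (to-from w)))
                       (trans (cong from (sym (hom c (from w)))) (from-to _))

≅-trans : ∀ {Γ Δ Θ} → Γ ≅ Δ → Δ ≅ Θ → Γ ≅ Θ
≅-trans φ ψ = record
  { to = Ψ.to ∘ Φ.to ; from = Φ.from ∘ Ψ.from
  ; from-to = λ v → trans (cong Φ.from (Ψ.from-to _)) (Φ.from-to v)
  ; to-from = λ v → trans (cong Ψ.to (Φ.to-from _)) (Ψ.to-from v)
  ; hom = λ c v → trans (cong Ψ.to (Φ.hom c v)) (Ψ.hom c _) }
  where
  module Φ = _≅_ φ
  module Ψ = _≅_ ψ

≅-to-injective : ∀ {Γ Δ} (φ : Γ ≅ Δ) {u v} → _≅_.to φ u ≡ _≅_.to φ v → u ≡ v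
≅-to-injective φ {u} {v} e = trans (sym (from-to u)) (trans (cong from e) (from-to v))
  where open _≅_ φ

IsConnSumAt-sym : ∀ {Γ A B a b} → IsConnSumAt Γ A B a b → IsConnSumAt Γ B A b a
IsConnSumAt-sym {Γ} {A} {B} {a} {b} S = record
  { ι₁ = S.ι₂ ; ι₂ = S.ι₁ ; inj₁ = S.inj₂ ; inj₂ = S.inj₁
  ; disj = λ β α β≢b α≢a e → S.disj α β α≢a β≢b (sym e)
  ; cover = swap ∘ S.cover
  ; edge₁ = S.edge₂ ; edge₂ = S.edge₁
  ; new = λ c → σ-ι₂-glued c (σ B c b) (invol B c b) }
  where
  module S = IsConnSumAt S
  open Summands S using (σ-ι₂-glued)
  swap : ∀ {v} → (Σ[ α ∈ Fin (n A) ] (α ≢ a × S.ι₁ α ≡ v)) ⊎ (Σ[ β ∈ Fin (n B) ] (β ≢ b × S.ι₂ β ≡ v))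
       → (Σ[ β ∈ Fin (n B) ] (β ≢ b × S.ι₂ β ≡ v)) ⊎ (Σ[ α ∈ Fin (n A) ] (α ≢ a × S.ι₁ α ≡ v))
  swap (inj₁ x) = inj₂ x
  swap (inj₂ y) = inj₁ y

IsConnSumAt-≅ʳ : ∀ {Γ A B B′ a b} (φ : B ≅ B′) → IsConnSumAt Γ A B a b → IsConnSumAt Γ A B′ a (_≅_.to φ b)
IsConnSumAt-≅ʳ {Γ} {A} {B} {B′} {a} {b} φ S = record
  { ι₁ = S.ι₁ ; ι₂ = S.ι₂ ∘ from
  ; inj₁ = S.inj₁
  ; inj₂ = λ x y p q e → trans (sym (to-from x)) (trans (cong to (S.inj₂ _ _ (from≢ p) (from≢ q) e)) (to-from y))
  ; disj = λ x y p q → S.disj x _ p (from≢ q)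
  ; cover = cover
  ; edge₁ = S.edge₁
  ; edge₂ = λ c y p q → trans (S.edge₂ c (from y) (from≢ p) (λ e → from≢ q (trans (from-hom c y) e)))
                              (cong S.ι₂ (sym (from-hom c y)))
  ; new = λ c → trans (S.new c) (cong S.ι₂ (trans (cong (σ B c) (sym (from-to b))) (sym (from-hom c (to b))))) }
  where
  module S = IsConnSumAt S
  open _≅_ φ
  from-hom : ∀ c y → from (σ B′ c y) ≡ σ B c (from y)
  from-hom = _≅_.hom (≅-sym φ)
  from≢ : ∀ {y} → y ≢ to b → from y ≢ b
  from≢ {y} p e = p (trans (sym (to-from y)) (cong to e))
  cover : ∀ v → (Σ[ α ∈ Fin (n A) ] (α ≢ a × S.ι₁ α ≡ v)) ⊎ (Σ[ β ∈ Fin (n B′) ] (β ≢ to b × S.ι₂ (from β) ≡ v))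
  cover v with S.cover v
  ... | inj₁ x = inj₁ x
  ... | inj₂ (β , β≢b , e) = inj₂ (to β , (λ q → β≢b (≅-to-injective φ q)) , trans (cong S.ι₂ (from-to β)) e)

IsConnSumAt-≅ˡ : ∀ {Γ A A′ B a b} (φ : A ≅ A′) → IsConnSumAt Γ A B a b → IsConnSumAt Γ A′ B (_≅_.to φ a) b
IsConnSumAt-≅ˡ φ = IsConnSumAt-sym ∘ IsConnSumAt-≅ʳ φ ∘ IsConnSumAt-sym

IsConnSumAt-unique : ∀ {Γ Γ′ A B a b} → IsConnSumAt Γ A B a b → IsConnSumAt Γ′ A B a b → Γ ≅ Γ′
IsConnSumAt-unique {Γ} {Γ′} {A} {B} {a} {b} S S′ = record
  { to = to ; from = from ; from-to = from-to ; to-from = to-from ; hom = hom }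
  where
  module S = IsConnSumAt S
  module S′ = IsConnSumAt S′
  module V = Summands S
  module V′ = Summands S′
  to : Fin (n Γ) → Fin (n Γ′)
  to = V.vertex-rec S′.ι₁ S′.ι₂
  from : Fin (n Γ′) → Fin (n Γ)
  from = V′.vertex-rec S.ι₁ S.ι₂
  from-to : ∀ v → from (to v) ≡ v
  from-to = V.vertex-ind _ (λ α p → trans (cong from (V.vertex-rec-ι₁ _ _ α p)) (V′.vertex-rec-ι₁ _ _ α p))
                           (λ β p → trans (cong from (V.vertex-rec-ι₂ _ _ β p)) (V′.vertex-rec-ι₂ _ _ β p))
  to-from : ∀ v → to (from v) ≡ v
  to-from = V′.vertex-ind _ (λ α p → trans (cong to (V′.vertex-rec-ι₁ _ _ α p)) (V.vertex-rec-ι₁ _ _ α p))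
                            (λ β p → trans (cong to (V′.vertex-rec-ι₂ _ _ β p)) (V.vertex-rec-ι₂ _ _ β p))
  hom-ι₁ : ∀ c α → α ≢ a → to (σ Γ c (S.ι₁ α)) ≡ σ Γ′ c (to (S.ι₁ α))
  hom-ι₁ c α p rewrite V.vertex-rec-ι₁ S′.ι₁ S′.ι₂ α p with V.σ-ι₁-cases c α p | V′.σ-ι₁-cases c α p
  ... | inj₁ (_ , q) | inj₁ (_ , q′) rewrite q | q′ = V.vertex-rec-ι₂ _ _ _ (loopless B c b)
  ... | inj₂ (e , q) | inj₂ (_ , q′) rewrite q | q′ = V.vertex-rec-ι₁ _ _ _ e
  ... | inj₁ (e , _) | inj₂ (e′ , _) = ⊥-elim (e′ e)
  ... | inj₂ (e , _) | inj₁ (e′ , _) = ⊥-elim (e e′)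
  hom-ι₂ : ∀ c β → β ≢ b → to (σ Γ c (S.ι₂ β)) ≡ σ Γ′ c (to (S.ι₂ β))
  hom-ι₂ c β p rewrite V.vertex-rec-ι₂ S′.ι₁ S′.ι₂ β p with V.σ-ι₂-cases c β p | V′.σ-ι₂-cases c β p
  ... | inj₁ (_ , q) | inj₁ (_ , q′) rewrite q | q′ = V.vertex-rec-ι₁ _ _ _ (loopless A c a)
  ... | inj₂ (e , q) | inj₂ (_ , q′) rewrite q | q′ = V.vertex-rec-ι₂ _ _ _ e
  ... | inj₁ (e , _) | inj₂ (e′ , _) = ⊥-elim (e′ e)
  ... | inj₂ (e , _) | inj₁ (e′ , _) = ⊥-elim (e e′)
  hom : ∀ c v → to (σ Γ c v) ≡ σ Γ′ c (to v)
  hom c = V.vertex-ind _ (hom-ι₁ c) (hom-ι₂ c)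

-- Associativity

module Reassociate {Γ X D A B W : CG} {x : Fin (n X)} {d : Fin (n D)} {a : Fin (n A)} {b β : Fin (n B)}
  (SΓ : IsConnSumAt Γ X D x d) (SX : IsConnSumAt X A B a b) (β≢b : β ≢ b)
  (ι₂β≡x : IsConnSumAt.ι₂ SX β ≡ x) (SW : IsConnSumAt W B D β d) where
  module XD = IsConnSumAt SΓ
  module AB = IsConnSumAt SX
  module BD = IsConnSumAt SW
  module XDᵛ = Summands SΓ
  module BDᵛ = Summands SW

  ι₁A : Fin (n A) → Fin (n Γ)
  ι₁A α = XD.ι₁ (AB.ι₁ α)

  ι₂W : Fin (n W) → Fin (n Γ)
  ι₂W = BDᵛ.vertex-rec (XD.ι₁ ∘ AB.ι₂) XD.ι₂

  w₀ : Fin (n W)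
  w₀ = BD.ι₁ b

  AB-ι₁≢x : ∀ α → α ≢ a → AB.ι₁ α ≢ x
  AB-ι₁≢x α p e = AB.disj α β p β≢b (trans e (sym ι₂β≡x))

  AB-ι₂≢x : ∀ b′ → b′ ≢ b → b′ ≢ β → AB.ι₂ b′ ≢ x
  AB-ι₂≢x b′ p q e = q (AB.inj₂ b′ β p β≢b (trans e (sym ι₂β≡x)))

  ι₂W-ι₁ : ∀ b′ → b′ ≢ β → ι₂W (BD.ι₁ b′) ≡ XD.ι₁ (AB.ι₂ b′)
  ι₂W-ι₁ b′ p = BDᵛ.vertex-rec-ι₁ _ _ b′ p

  ι₂W-ι₂ : ∀ δ → δ ≢ d → ι₂W (BD.ι₂ δ) ≡ XD.ι₂ δ
  ι₂W-ι₂ δ p = BDᵛ.vertex-rec-ι₂ _ _ δ p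

  ≢w₀⇒≢b : ∀ {b′} → BD.ι₁ b′ ≢ w₀ → b′ ≢ b
  ≢w₀⇒≢b q e = q (cong BD.ι₁ e)

  ι₂B≢x : ∀ {b′} → b′ ≢ β → BD.ι₁ b′ ≢ w₀ → AB.ι₂ b′ ≢ x
  ι₂B≢x {b′} p y = AB-ι₂≢x b′ (≢w₀⇒≢b y) p

  inj₁A : ∀ α α′ → α ≢ a → α′ ≢ a → ι₁A α ≡ ι₁A α′ → α ≡ α′
  inj₁A α α′ p q e = AB.inj₁ α α′ p q (XD.inj₁ _ _ (AB-ι₁≢x α p) (AB-ι₁≢x α′ q) e)

  inj₂W : ∀ y y′ → y ≢ w₀ → y′ ≢ w₀ → ι₂W y ≡ ι₂W y′ → y ≡ y′
  inj₂W = BDᵛ.vertex-ind _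
    (λ b₁ p₁ → BDᵛ.vertex-ind _ (B-B b₁ p₁) (B-D b₁ p₁))
    (λ δ₁ q₁ → BDᵛ.vertex-ind _ (λ b₂ p₂ y₁ y₂ e → sym (B-D b₂ p₂ δ₁ q₁ y₂ y₁ (sym e))) (D-D δ₁ q₁))
    where
    B-B : ∀ b₁ → b₁ ≢ β → ∀ b₂ → b₂ ≢ β → BD.ι₁ b₁ ≢ w₀ → BD.ι₁ b₂ ≢ w₀ →
         ι₂W (BD.ι₁ b₁) ≡ ι₂W (BD.ι₁ b₂) → BD.ι₁ b₁ ≡ BD.ι₁ b₂
    B-B b₁ p₁ b₂ p₂ y₁ y₂ e = cong BD.ι₁ (AB.inj₂ b₁ b₂ (≢w₀⇒≢b y₁) (≢w₀⇒≢b y₂)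
      (XD.inj₁ _ _ (ι₂B≢x p₁ y₁) (ι₂B≢x p₂ y₂) (trans (sym (ι₂W-ι₁ b₁ p₁)) (trans e (ι₂W-ι₁ b₂ p₂)))))
    B-D : ∀ b₁ → b₁ ≢ β → ∀ δ → δ ≢ d → BD.ι₁ b₁ ≢ w₀ → BD.ι₂ δ ≢ w₀ →
          ι₂W (BD.ι₁ b₁) ≡ ι₂W (BD.ι₂ δ) → BD.ι₁ b₁ ≡ BD.ι₂ δ
    B-D b₁ p₁ δ q y₁ _ e =
      ⊥-elim (XD.disj _ δ (ι₂B≢x p₁ y₁) q (trans (sym (ι₂W-ι₁ b₁ p₁)) (trans e (ι₂W-ι₂ δ q))))
    D-D : ∀ δ₁ → δ₁ ≢ d → ∀ δ₂ → δ₂ ≢ d → BD.ι₂ δ₁ ≢ w₀ → BD.ι₂ δ₂ ≢ w₀ →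
         ι₂W (BD.ι₂ δ₁) ≡ ι₂W (BD.ι₂ δ₂) → BD.ι₂ δ₁ ≡ BD.ι₂ δ₂
    D-D δ₁ q₁ δ₂ q₂ _ _ e = cong BD.ι₂ (XD.inj₂ δ₁ δ₂ q₁ q₂ (trans (sym (ι₂W-ι₂ δ₁ q₁)) (trans e (ι₂W-ι₂ δ₂ q₂))))

  disj : ∀ α y → α ≢ a → y ≢ w₀ → ι₁A α ≢ ι₂W y
  disj α = BDᵛ.vertex-ind _
    (λ b′ p′ q y e → AB.disj α b′ q (≢w₀⇒≢b y)
                       (XD.inj₁ _ _ (AB-ι₁≢x α q) (ι₂B≢x p′ y) (trans e (ι₂W-ι₁ b′ p′))))
    (λ δ p′ q y e → XD.disj _ δ (AB-ι₁≢x α q) p′ (trans e (ι₂W-ι₂ δ p′)))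

  cover : ∀ z → (Σ[ α ∈ Fin (n A) ] (α ≢ a × ι₁A α ≡ z)) ⊎ (Σ[ y ∈ Fin (n W) ] (y ≢ w₀ × ι₂W y ≡ z))
  cover = XDᵛ.vertex-ind _ cover-X cover-D
    where
    cover-X : ∀ ξ → ξ ≢ x → _
    cover-X ξ p with AB.cover ξ
    ... | inj₁ (α , q , refl) = inj₁ (α , q , refl)
    ... | inj₂ (b′ , q , refl) = inj₂ (BD.ι₁ b′ , (λ e → q (BD.inj₁ b′ b b′≢β (≢-sym β≢b) e)) , ι₂W-ι₁ b′ b′≢β)
      where
      b′≢β : b′ ≢ β
      b′≢β e = p (trans (cong AB.ι₂ e) ι₂β≡x)
    cover-D : ∀ δ → δ ≢ d → _
    cover-D δ p = inj₂ (BD.ι₂ δ , (λ e → BD.disj b δ (≢-sym β≢b) p (sym e)) , ι₂W-ι₂ δ p)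

  edge₁ : ∀ c α → α ≢ a → σ A c α ≢ a → σ Γ c (ι₁A α) ≡ ι₁A (σ A c α)
  edge₁ c α p q = trans (XD.edge₁ c _ (AB-ι₁≢x α p) (λ e → AB-ι₁≢x _ q (trans (sym (AB.edge₁ c α p q)) e)))
                        (cong XD.ι₁ (AB.edge₁ c α p q))

  edge₂-B : ∀ c b′ → b′ ≢ β → BD.ι₁ b′ ≢ w₀ → σ W c (BD.ι₁ b′) ≢ w₀ →
            σ Γ c (ι₂W (BD.ι₁ b′)) ≡ ι₂W (σ W c (BD.ι₁ b′))
  edge₂-B c b′ p y sy rewrite ι₂W-ι₁ b′ p with BDᵛ.σ-ι₁-cases c b′ p
  ... | inj₁ (e , q) rewrite q | ι₂W-ι₂ (σ D c d) (loopless D c d) = glued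
    where
    σb′↦x : σ X c (AB.ι₂ b′) ≡ x
    σb′↦x = trans (AB.edge₂ c b′ (≢w₀⇒≢b y) (λ z → β≢b (trans (sym e) z))) (trans (cong AB.ι₂ e) ι₂β≡x)
    glued : σ Γ c (XD.ι₁ (AB.ι₂ b′)) ≡ XD.ι₂ (σ D c d)
    glued with XDᵛ.σ-ι₁-cases c (AB.ι₂ b′) (ι₂B≢x p y)
    ... | inj₁ (_ , r) = r
    ... | inj₂ (r , _) = ⊥-elim (r σb′↦x)
  ... | inj₂ (e , q) rewrite q | ι₂W-ι₁ (σ B c b′) e =
    trans (XD.edge₁ c _ (ι₂B≢x p y) (λ z → AB-ι₂≢x _ σb′≢b e (trans (sym σb′↦) z))) (cong XD.ι₁ σb′↦)
    where
    σb′≢b : σ B c b′ ≢ b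
    σb′≢b z = sy (cong BD.ι₁ z)
    σb′↦ : σ X c (AB.ι₂ b′) ≡ AB.ι₂ (σ B c b′)
    σb′↦ = AB.edge₂ c b′ (≢w₀⇒≢b y) σb′≢b

  edge₂-D : ∀ c δ → δ ≢ d → σ W c (BD.ι₂ δ) ≢ w₀ → σ Γ c (ι₂W (BD.ι₂ δ)) ≡ ι₂W (σ W c (BD.ι₂ δ))
  edge₂-D c δ p sy rewrite ι₂W-ι₂ δ p with BDᵛ.σ-ι₂-cases c δ p
  ... | inj₁ (e , q) rewrite q | ι₂W-ι₁ (σ B c β) (loopless B c β) =
    trans glued (cong XD.ι₁ (trans (cong (σ X c) (sym ι₂β≡x)) (AB.edge₂ c β β≢b σβ≢b)))
    where
    σβ≢b : σ B c β ≢ b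
    σβ≢b z = sy (cong BD.ι₁ z)
    glued : σ Γ c (XD.ι₂ δ) ≡ XD.ι₁ (σ X c x)
    glued with XDᵛ.σ-ι₂-cases c δ p
    ... | inj₁ (_ , r) = r
    ... | inj₂ (r , _) = ⊥-elim (r e)
  ... | inj₂ (e , q) rewrite q | ι₂W-ι₂ (σ D c δ) e = XD.edge₂ c δ p e

  edge₂ : ∀ c y → y ≢ w₀ → σ W c y ≢ w₀ → σ Γ c (ι₂W y) ≡ ι₂W (σ W c y)
  edge₂ c = BDᵛ.vertex-ind _ (edge₂-B c) (λ δ p _ → edge₂-D c δ p)

  new : ∀ c → σ Γ c (ι₁A (σ A c a)) ≡ ι₂W (σ W c w₀)
  new c with σ B c b ≟ β
  ... | yes e = trans glued (sym (trans (cong ι₂W σw₀) (ι₂W-ι₂ _ (loopless D c d))))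
    where
    σ↦x : σ X c (AB.ι₁ (σ A c a)) ≡ x
    σ↦x = trans (AB.new c) (trans (cong AB.ι₂ e) ι₂β≡x)
    glued : σ Γ c (XD.ι₁ (AB.ι₁ (σ A c a))) ≡ XD.ι₂ (σ D c d)
    glued with XDᵛ.σ-ι₁-cases c (AB.ι₁ (σ A c a)) (AB-ι₁≢x _ (loopless A c a))
    ... | inj₁ (_ , r) = r
    ... | inj₂ (r , _) = ⊥-elim (r σ↦x)
    σw₀ : σ W c (BD.ι₁ b) ≡ BD.ι₂ (σ D c d)
    σw₀ with BDᵛ.σ-ι₁-cases c b (≢-sym β≢b)
    ... | inj₁ (_ , r) = r
    ... | inj₂ (r , _) = ⊥-elim (r e)
  ... | no q = trans (XD.edge₁ c _ (AB-ι₁≢x _ (loopless A c a))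
                                   (λ z → AB-ι₂≢x _ (loopless B c b) q (trans (sym (AB.new c)) z)))
                     (trans (cong XD.ι₁ (AB.new c))
                            (sym (trans (cong ι₂W (BD.edge₁ c b (≢-sym β≢b) q)) (ι₂W-ι₁ _ q))))

  result : IsConnSumAt Γ A W a w₀
  result = record { ι₁ = ι₁A ; ι₂ = ι₂W ; inj₁ = inj₁A ; inj₂ = inj₂W ; disj = disj ; cover = cover
                  ; edge₁ = edge₁ ; edge₂ = edge₂ ; new = new }

module _ {Γ X D A B W : CG} {x : Fin (n X)} {d : Fin (n D)} {a : Fin (n A)} {b β : Fin (n B)}
  (SΓ : IsConnSumAt Γ X D x d) (SX : IsConnSumAt X A B a b) (β≢b : β ≢ b)
  (ι₂β≡x : IsConnSumAt.ι₂ SX β ≡ x) (SW : IsConnSumAt W B D β d) where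

  #-assocʳ : IsConnSumAt Γ A W a (IsConnSumAt.ι₁ SW b)
  #-assocʳ = Reassociate.result SΓ SX β≢b ι₂β≡x SW

  #-assocʳ-ι₂-ι₂ : ∀ δ → δ ≢ d → IsConnSumAt.ι₂ #-assocʳ (IsConnSumAt.ι₂ SW δ) ≡ IsConnSumAt.ι₂ SΓ δ
  #-assocʳ-ι₂-ι₂ = Reassociate.ι₂W-ι₂ SΓ SX β≢b ι₂β≡x SW

module _ {Γ A W B D V : CG} {a : Fin (n A)} {w : Fin (n W)} {b β : Fin (n B)} {d : Fin (n D)}
  (SΓ : IsConnSumAt Γ A W a w) (SW : IsConnSumAt W B D β d) (b≢β : b ≢ β)
  (ι₁b≡w : IsConnSumAt.ι₁ SW b ≡ w) (SV : IsConnSumAt V A B a b) where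

  #-assocˡ : IsConnSumAt Γ V D (IsConnSumAt.ι₂ SV β) d
  #-assocˡ = IsConnSumAt-sym
    (#-assocʳ (IsConnSumAt-sym SΓ) (IsConnSumAt-sym SW) b≢β ι₁b≡w (IsConnSumAt-sym SV))

  #-assocˡ-ι₁-ι₁ : ∀ α → α ≢ a → IsConnSumAt.ι₁ #-assocˡ (IsConnSumAt.ι₁ SV α) ≡ IsConnSumAt.ι₁ SΓ α
  #-assocˡ-ι₁-ι₁ = #-assocʳ-ι₂-ι₂ (IsConnSumAt-sym SΓ) (IsConnSumAt-sym SW) b≢β ι₁b≡w (IsConnSumAt-sym SV)

-- Simple cuts inside connected sums

module LiftCut {W Ŵ : CG} {z₁ z₂ : Fin (n Ŵ)} {Γ Γ̂ C : CG} {v : Fin (n C)} {w : Fin (n W)}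
  (cut : SimpleCut W Ŵ z₁ z₂) (S : IsConnSumAt Γ C W v w) (Ŝ : IsConnSumAt Γ̂ C Ŵ v (SimpleCut.ι cut w)) where
  module Cut = SimpleCut cut
  module CW = IsConnSumAt S
  module CŴ = IsConnSumAt Ŝ
  module CWᵛ = Summands S
  module CŴᵛ = Summands Ŝ

  ŵ : Fin (n Ŵ)
  ŵ = Cut.ι w

  z₁≢ŵ : z₁ ≢ ŵ
  z₁≢ŵ = ≢-sym (Cut.ι≢z₁ w)

  z₂≢ŵ : z₂ ≢ ŵ
  z₂≢ŵ = ≢-sym (Cut.ι≢z₂ w)

  ι≢ŵ : ∀ {β} → β ≢ w → Cut.ι β ≢ ŵ
  ι≢ŵ β≢w e = β≢w (Cut.ι-inj _ w e)

  embed : Fin (n Γ) → Fin (n Γ̂)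
  embed = CWᵛ.vertex-rec CŴ.ι₁ (CŴ.ι₂ ∘ Cut.ι)

  embed-ι₁ : ∀ α → α ≢ v → embed (CW.ι₁ α) ≡ CŴ.ι₁ α
  embed-ι₁ = CWᵛ.vertex-rec-ι₁ _ _

  embed-ι₂ : ∀ β → β ≢ w → embed (CW.ι₂ β) ≡ CŴ.ι₂ (Cut.ι β)
  embed-ι₂ = CWᵛ.vertex-rec-ι₂ _ _

  embed-injective : ∀ x y → embed x ≡ embed y → x ≡ y
  embed-injective = CWᵛ.vertex-ind _ (λ α p → CWᵛ.vertex-ind _ (C-C α p) (C-W α p))
                                     (λ β q → CWᵛ.vertex-ind _ (λ α p e → sym (C-W α p β q (sym e))) (W-W β q))
    where
    C-C : ∀ α → α ≢ v → ∀ α′ → α′ ≢ v → embed (CW.ι₁ α) ≡ embed (CW.ι₁ α′) → CW.ι₁ α ≡ CW.ι₁ α′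
    C-C α p α′ p′ e = cong CW.ι₁ (CŴ.inj₁ α α′ p p′ (trans (sym (embed-ι₁ α p)) (trans e (embed-ι₁ α′ p′))))
    C-W : ∀ α → α ≢ v → ∀ β → β ≢ w → embed (CW.ι₁ α) ≡ embed (CW.ι₂ β) → CW.ι₁ α ≡ CW.ι₂ β
    C-W α p β q e = ⊥-elim (CŴ.disj α _ p (ι≢ŵ q) (trans (sym (embed-ι₁ α p)) (trans e (embed-ι₂ β q))))
    W-W : ∀ β → β ≢ w → ∀ β′ → β′ ≢ w → embed (CW.ι₂ β) ≡ embed (CW.ι₂ β′) → CW.ι₂ β ≡ CW.ι₂ β′
    W-W β q β′ q′ e = cong CW.ι₂ (Cut.ι-inj β β′
      (CŴ.inj₂ _ _ (ι≢ŵ q) (ι≢ŵ q′) (trans (sym (embed-ι₂ β q)) (trans e (embed-ι₂ β′ q′)))))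

  embed≢ι₂ : ∀ z → z ≢ ŵ → (∀ β → Cut.ι β ≢ z) → ∀ x → embed x ≢ CŴ.ι₂ z
  embed≢ι₂ z z≢ŵ ι≢z = CWᵛ.vertex-ind _
    (λ α p e → CŴ.disj α z p z≢ŵ (trans (sym (embed-ι₁ α p)) e))
    (λ β q e → ι≢z β (CŴ.inj₂ _ _ (ι≢ŵ q) z≢ŵ (trans (sym (embed-ι₂ β q)) e)))

  embed-cover : ∀ y → y ≢ CŴ.ι₂ z₁ → y ≢ CŴ.ι₂ z₂ → Σ[ x ∈ Fin (n Γ) ] embed x ≡ y
  embed-cover = CŴᵛ.vertex-ind _ (λ α p _ _ → CW.ι₁ α , embed-ι₁ α p) from-Ŵ
    where
    from-Ŵ : ∀ u → u ≢ ŵ → CŴ.ι₂ u ≢ CŴ.ι₂ z₁ → CŴ.ι₂ u ≢ CŴ.ι₂ z₂ → Σ[ x ∈ Fin (n Γ) ] embed x ≡ CŴ.ι₂ u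
    from-Ŵ u u≢ŵ u≢z₁ u≢z₂ with Cut.ι-cover u (u≢z₁ ∘ cong CŴ.ι₂) (u≢z₂ ∘ cong CŴ.ι₂)
    ... | β , ιβ≡u = CW.ι₂ β , trans (embed-ι₂ β β≢w) (cong CŴ.ι₂ ιβ≡u)
      where
      β≢w : β ≢ w
      β≢w β≡w = u≢ŵ (trans (sym ιβ≡u) (cong Cut.ι β≡w))

  embed-col2 : ∀ x → σ Γ̂ c2 (embed x) ≡ embed (σ Γ c2 x)
  embed-col2 = CWᵛ.vertex-ind _ from-C from-W
    where
    from-C : ∀ α → α ≢ v → σ Γ̂ c2 (embed (CW.ι₁ α)) ≡ embed (σ Γ c2 (CW.ι₁ α))
    from-C α p rewrite embed-ι₁ α p with CWᵛ.σ-ι₁-cases c2 α p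
    ... | inj₁ (e , q) rewrite q | embed-ι₂ (σ W c2 w) (loopless W c2 w) =
      trans (CŴᵛ.σ-ι₁-glued c2 α e) (cong CŴ.ι₂ (Cut.col2 w))
    ... | inj₂ (e , q) rewrite q | embed-ι₁ (σ C c2 α) e = CŴ.edge₁ c2 α p e
    from-W : ∀ β → β ≢ w → σ Γ̂ c2 (embed (CW.ι₂ β)) ≡ embed (σ Γ c2 (CW.ι₂ β))
    from-W β p rewrite embed-ι₂ β p with CWᵛ.σ-ι₂-cases c2 β p
    ... | inj₁ (e , q) rewrite q | embed-ι₁ (σ C c2 v) (loopless C c2 v) =
      CŴᵛ.σ-ι₂-glued c2 (Cut.ι β) (trans (Cut.col2 β) (cong Cut.ι e))
    ... | inj₂ (e , q) rewrite q | embed-ι₂ (σ W c2 β) e =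
      trans (CŴ.edge₂ c2 (Cut.ι β) (ι≢ŵ p) (λ r → ι≢ŵ e (trans (sym (Cut.col2 β)) r))) (cong CŴ.ι₂ (Cut.col2 β))

  module _ (k : Color) (zA zB : Fin (n Ŵ)) (zA≢ŵ : zA ≢ ŵ) (zB≢ŵ : zB ≢ ŵ)
           (cut-at-zA : ∀ β → σ Ŵ k (Cut.ι β) ≡ zA → Cut.ι (σ W k β) ≡ σ Ŵ k zB) where

    embed-col01-cut : ∀ x → σ Γ̂ k (embed x) ≡ CŴ.ι₂ zA → embed (σ Γ k x) ≡ σ Γ̂ k (CŴ.ι₂ zB)
    embed-col01-cut = CWᵛ.vertex-ind _ from-C from-W
      where
      from-C : ∀ α → α ≢ v → σ Γ̂ k (embed (CW.ι₁ α)) ≡ CŴ.ι₂ zA → embed (σ Γ k (CW.ι₁ α)) ≡ σ Γ̂ k (CŴ.ι₂ zB)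
      from-C α p h rewrite embed-ι₁ α p with CWᵛ.σ-ι₁-cases k α p
      ... | inj₂ (e , q) = ⊥-elim (CŴ.disj _ zA e zA≢ŵ (trans (sym (CŴ.edge₁ k α p e)) h))
      ... | inj₁ (e , q) rewrite q | embed-ι₂ (σ W k w) (loopless W k w) =
        trans (cong CŴ.ι₂ ισw) (sym (CŴ.edge₂ k zB zB≢ŵ (λ r → ι≢ŵ (loopless W k w) (trans ισw r))))
        where
        ισw : Cut.ι (σ W k w) ≡ σ Ŵ k zB
        ισw = cut-at-zA w (CŴ.inj₂ _ _ (loopless Ŵ k ŵ) zA≢ŵ (trans (sym (CŴᵛ.σ-ι₁-glued k α e)) h))
      from-W : ∀ β → β ≢ w → σ Γ̂ k (embed (CW.ι₂ β)) ≡ CŴ.ι₂ zA → embed (σ Γ k (CW.ι₂ β)) ≡ σ Γ̂ k (CŴ.ι₂ zB)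
      from-W β p h rewrite embed-ι₂ β p with CŴᵛ.σ-ι₂-cases k (Cut.ι β) (ι≢ŵ p)
      ... | inj₁ (e , q) = ⊥-elim (CŴ.disj _ zA (loopless C k v) zA≢ŵ (trans (sym q) h))
      ... | inj₂ (e , q) with σ W k β ≟ w
      ...   | yes σβ≡w = begin
        embed (σ Γ k (CW.ι₂ β))   ≡⟨ cong embed (CWᵛ.σ-ι₂-glued k β σβ≡w) ⟩
        embed (CW.ι₁ (σ C k v))   ≡⟨ embed-ι₁ _ (loopless C k v) ⟩
        CŴ.ι₁ (σ C k v)           ≡⟨ CŴᵛ.σ-ι₂-glued k zB (trans (sym ισβ) (cong Cut.ι σβ≡w)) ⟨
        σ Γ̂ k (CŴ.ι₂ zB)          ∎
        where
        open ≡-Reasoning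
        ισβ : Cut.ι (σ W k β) ≡ σ Ŵ k zB
        ισβ = cut-at-zA β (CŴ.inj₂ _ _ e zA≢ŵ (trans (sym q) h))
      ...   | no σβ≢w = begin
        embed (σ Γ k (CW.ι₂ β))   ≡⟨ cong embed (CW.edge₂ k β p σβ≢w) ⟩
        embed (CW.ι₂ (σ W k β))   ≡⟨ embed-ι₂ _ σβ≢w ⟩
        CŴ.ι₂ (Cut.ι (σ W k β))   ≡⟨ cong CŴ.ι₂ ισβ ⟩
        CŴ.ι₂ (σ Ŵ k zB)          ≡⟨ CŴ.edge₂ k zB zB≢ŵ (λ r → ι≢ŵ σβ≢w (trans ισβ r)) ⟨
        σ Γ̂ k (CŴ.ι₂ zB)          ∎
        where
        open ≡-Reasoning
        ισβ : Cut.ι (σ W k β) ≡ σ Ŵ k zB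
        ισβ = cut-at-zA β (CŴ.inj₂ _ _ e zA≢ŵ (trans (sym q) h))

  embed-col01-uncut : ∀ k → k ≢ c2 → ∀ x → σ Γ̂ k (embed x) ≢ CŴ.ι₂ z₁ → σ Γ̂ k (embed x) ≢ CŴ.ι₂ z₂ →
                      σ Γ̂ k (embed x) ≡ embed (σ Γ k x)
  embed-col01-uncut k k≢2 = CWᵛ.vertex-ind _ from-C from-W
    where
    uncut : ∀ β → σ Ŵ k (Cut.ι β) ≢ z₁ → σ Ŵ k (Cut.ι β) ≢ z₂ → σ Ŵ k (Cut.ι β) ≡ Cut.ι (σ W k β)
    uncut β = proj₁ (Cut.col01 k k≢2 β)
    from-C : ∀ α → α ≢ v → σ Γ̂ k (embed (CW.ι₁ α)) ≢ CŴ.ι₂ z₁ → σ Γ̂ k (embed (CW.ι₁ α)) ≢ CŴ.ι₂ z₂ →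
             σ Γ̂ k (embed (CW.ι₁ α)) ≡ embed (σ Γ k (CW.ι₁ α))
    from-C α p h₁ h₂ rewrite embed-ι₁ α p with CWᵛ.σ-ι₁-cases k α p
    ... | inj₂ (e , q) rewrite q | embed-ι₁ (σ C k α) e = CŴ.edge₁ k α p e
    ... | inj₁ (e , q) rewrite q | embed-ι₂ (σ W k w) (loopless W k w) | CŴᵛ.σ-ι₁-glued k α e =
      cong CŴ.ι₂ (uncut w (h₁ ∘ cong CŴ.ι₂) (h₂ ∘ cong CŴ.ι₂))
    from-W : ∀ β → β ≢ w → σ Γ̂ k (embed (CW.ι₂ β)) ≢ CŴ.ι₂ z₁ → σ Γ̂ k (embed (CW.ι₂ β)) ≢ CŴ.ι₂ z₂ →
             σ Γ̂ k (embed (CW.ι₂ β)) ≡ embed (σ Γ k (CW.ι₂ β))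
    from-W β p h₁ h₂ rewrite embed-ι₂ β p with CŴᵛ.σ-ι₂-cases k (Cut.ι β) (ι≢ŵ p)
    ... | inj₁ (e , q) rewrite q =
      trans (sym (embed-ι₁ _ (loopless C k v))) (cong embed (sym (CWᵛ.σ-ι₂-glued k β σβ≡w)))
      where
      σβ≡w : σ W k β ≡ w
      σβ≡w = Cut.ι-inj _ _ (trans (sym (uncut β (Cut.ι≢z₁ w ∘ trans (sym e)) (Cut.ι≢z₂ w ∘ trans (sym e)))) e)
    ... | inj₂ (e , q) rewrite q =
      trans (cong CŴ.ι₂ ισβ) (trans (sym (embed-ι₂ _ σβ≢w)) (cong embed (sym (CW.edge₂ k β p σβ≢w))))
      where
      ισβ : σ Ŵ k (Cut.ι β) ≡ Cut.ι (σ W k β)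
      ισβ = uncut β (h₁ ∘ cong CŴ.ι₂) (h₂ ∘ cong CŴ.ι₂)
      σβ≢w : σ W k β ≢ w
      σβ≢w r = e (trans ισβ (cong Cut.ι r))

  embed-col01 : ∀ k → k ≢ c2 → ∀ x →
                (σ Γ̂ k (embed x) ≢ CŴ.ι₂ z₁ → σ Γ̂ k (embed x) ≢ CŴ.ι₂ z₂ → σ Γ̂ k (embed x) ≡ embed (σ Γ k x))
              × (σ Γ̂ k (embed x) ≡ CŴ.ι₂ z₁ → embed (σ Γ k x) ≡ σ Γ̂ k (CŴ.ι₂ z₂))
              × (σ Γ̂ k (embed x) ≡ CŴ.ι₂ z₂ → embed (σ Γ k x) ≡ σ Γ̂ k (CŴ.ι₂ z₁))
  embed-col01 k k≢2 x =
    embed-col01-uncut k k≢2 x ,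
    embed-col01-cut k z₁ z₂ z₁≢ŵ z₂≢ŵ (λ β → proj₁ (proj₂ (Cut.col01 k k≢2 β))) x ,
    embed-col01-cut k z₂ z₁ z₂≢ŵ z₁≢ŵ (λ β → proj₂ (proj₂ (Cut.col01 k k≢2 β))) x

  side : Fin (n Γ̂) → Bool
  side = CŴᵛ.vertex-rec (λ _ → Cut.side ŵ) Cut.side

  side-01 : ∀ k → k ≢ c2 → ∀ y → side (σ Γ̂ k y) ≡ side y
  side-01 k k≢2 = CŴᵛ.vertex-ind _ from-C from-Ŵ
    where
    from-C : ∀ α → α ≢ v → side (σ Γ̂ k (CŴ.ι₁ α)) ≡ side (CŴ.ι₁ α)
    from-C α p with CŴᵛ.σ-ι₁-cases k α p
    ... | inj₁ (e , q) rewrite q = trans (CŴᵛ.vertex-rec-ι₂ _ _ _ (loopless Ŵ k ŵ))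
                                         (trans (Cut.side-01 k k≢2 ŵ) (sym (CŴᵛ.vertex-rec-ι₁ _ _ α p)))
    ... | inj₂ (e , q) rewrite q = trans (CŴᵛ.vertex-rec-ι₁ _ _ _ e) (sym (CŴᵛ.vertex-rec-ι₁ _ _ α p))
    from-Ŵ : ∀ u → u ≢ ŵ → side (σ Γ̂ k (CŴ.ι₂ u)) ≡ side (CŴ.ι₂ u)
    from-Ŵ u p with CŴᵛ.σ-ι₂-cases k u p
    ... | inj₁ (e , q) rewrite q =
      trans (CŴᵛ.vertex-rec-ι₁ _ _ _ (loopless C k v))
            (trans (cong Cut.side (sym e)) (trans (Cut.side-01 k k≢2 u) (sym (CŴᵛ.vertex-rec-ι₂ _ _ u p))))
    ... | inj₂ (e , q) rewrite q =
      trans (CŴᵛ.vertex-rec-ι₂ _ _ _ e) (trans (Cut.side-01 k k≢2 u) (sym (CŴᵛ.vertex-rec-ι₂ _ _ u p)))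

  result : SimpleCut Γ Γ̂ (CŴ.ι₂ z₁) (CŴ.ι₂ z₂)
  result = record
    { z₁≢z₂ = Cut.z₁≢z₂ ∘ CŴ.inj₂ z₁ z₂ z₁≢ŵ z₂≢ŵ
    ; z-edge = trans (CŴ.edge₂ c2 z₁ z₁≢ŵ (z₂≢ŵ ∘ trans (sym Cut.z-edge))) (cong CŴ.ι₂ Cut.z-edge)
    ; ι = embed
    ; ι-inj = embed-injective
    ; ι≢z₁ = embed≢ι₂ z₁ z₁≢ŵ Cut.ι≢z₁
    ; ι≢z₂ = embed≢ι₂ z₂ z₂≢ŵ Cut.ι≢z₂
    ; ι-cover = embed-cover
    ; col2 = embed-col2
    ; col01 = embed-col01
    ; side = side
    ; side-z₁ = trans (CŴᵛ.vertex-rec-ι₂ _ _ z₁ z₁≢ŵ) Cut.side-z₁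
    ; side-z₂ = trans (CŴᵛ.vertex-rec-ι₂ _ _ z₂ z₂≢ŵ) Cut.side-z₂
    ; side-01 = side-01 }

module _ {W Ŵ : CG} {z₁ z₂ : Fin (n Ŵ)} {Γ Γ̂ C : CG} {v : Fin (n C)} {w : Fin (n W)} {ŵ : Fin (n Ŵ)}
  (cut : SimpleCut W Ŵ z₁ z₂) (S : IsConnSumAt Γ C W v w) (Ŝ : IsConnSumAt Γ̂ C Ŵ v ŵ) where

  simpleCut-# : SimpleCut.ι cut w ≡ ŵ → SimpleCut Γ Γ̂ (IsConnSumAt.ι₂ Ŝ z₁) (IsConnSumAt.ι₂ Ŝ z₂)
  simpleCut-# refl = LiftCut.result cut S Ŝ

  simpleCut-#-ι₂ : (ι≡ŵ : SimpleCut.ι cut w ≡ ŵ) → ∀ β → β ≢ w →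
                   SimpleCut.ι (simpleCut-# ι≡ŵ) (IsConnSumAt.ι₂ S β) ≡ IsConnSumAt.ι₂ Ŝ (SimpleCut.ι cut β)
  simpleCut-#-ι₂ refl = LiftCut.embed-ι₂ cut S Ŝ

record CutAndGlueAt (W : CG) (w : Fin (n W)) (W′ : CG) (w′ : Fin (n W′)) : Set where
  field
    Ŵ             : CG
    z₁ z₂ z₁′ z₂′ : Fin (n Ŵ)
    cut           : SimpleCut W Ŵ z₁ z₂
    cut′          : SimpleCut W′ Ŵ z₁′ z₂′
    ι≡ι′          : SimpleCut.ι cut w ≡ SimpleCut.ι cut′ w′

  cutAndGlue : CutAndGlue W W′
  cutAndGlue = Ŵ , z₁ , z₂ , z₁′ , z₂′ , cut , cut′

module _ {W W′ Γ Γ′ C : CG} {w : Fin (n W)} {w′ : Fin (n W′)} {v : Fin (n C)}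
  (G : CutAndGlueAt W w W′ w′) (S : IsConnSumAt Γ C W v w) (S′ : IsConnSumAt Γ′ C W′ v w′) where
  open CutAndGlueAt G

  private
    Ŝ : IsConnSumAt (C #⟨ v ∣ SimpleCut.ι cut w ⟩ Ŵ) C Ŵ v (SimpleCut.ι cut w)
    Ŝ = #-isConnSumAt C v Ŵ (SimpleCut.ι cut w)

  cutAndGlue-# : CutAndGlue Γ Γ′
  cutAndGlue-# = _ , _ , _ , _ , _ , simpleCut-# cut S Ŝ refl , simpleCut-# cut′ S′ Ŝ (sym ι≡ι′)

  cutAndGlueAt-# : ∀ {y y′} → y ≢ w → y′ ≢ w′ → SimpleCut.ι cut y ≡ SimpleCut.ι cut′ y′ →
                   CutAndGlueAt Γ (IsConnSumAt.ι₂ S y) Γ′ (IsConnSumAt.ι₂ S′ y′)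
  cutAndGlueAt-# y≢w y′≢w′ ιy≡ι′y′ = record
    { cut = simpleCut-# cut S Ŝ refl
    ; cut′ = simpleCut-# cut′ S′ Ŝ (sym ι≡ι′)
    ; ι≡ι′ = trans (simpleCut-#-ι₂ cut S Ŝ refl _ y≢w)
                   (trans (cong (IsConnSumAt.ι₂ Ŝ) ιy≡ι′y′) (sym (simpleCut-#-ι₂ cut′ S′ Ŝ (sym ι≡ι′) _ y′≢w′))) }

-- 𝒟-equivalence, interchanges and 𝒫₁

move⇒∼𝒟 : ∀ {Γ Γ′} → Move Γ Γ′ → Γ ∼𝒟 Γ′
move⇒∼𝒟 = EqClosure.return

≅⇒∼𝒟 : ∀ {Γ Γ′} → Γ ≅ Γ′ → Γ ∼𝒟 Γ′
≅⇒∼𝒟 = move⇒∼𝒟 ∘ inj₁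

cutAndGlue⇒∼𝒟 : ∀ {Γ Γ′} → CutAndGlue Γ Γ′ → Γ ∼𝒟 Γ′
cutAndGlue⇒∼𝒟 = move⇒∼𝒟 ∘ inj₂ ∘ inj₁

module ∼𝒟-Reasoning = SetoidReasoning (EqClosure.setoid Move)

interchange : ∀ {Γ A B a b} → IsConnSumAt Γ A B a b → ¬ Bipartite A ⊎ ¬ Bipartite B →
              ∀ a′ b′ → Γ ∼𝒟 A #⟨ a′ ∣ b′ ⟩ B
interchange {a = a} {b} S nonbipartite a′ b′ with (a ≟ a′) ×-dec (b ≟ b′)
... | yes (refl , refl) = ≅⇒∼𝒟 (IsConnSumAt-unique S (#-isConnSumAt _ a _ b))
... | no moved = move⇒∼𝒟 (inj₂ (inj₂ (_ , _ , a , b , a′ , b′ , moved , S , #-isConnSumAt _ a′ _ b′ ,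
                                      [ inj₁ , inj₂ ∘ inj₁ ]′ nonbipartite)))

VertexTransitive : CG → Set
VertexTransitive Δ = ∀ u v → Σ[ φ ∈ Δ ≅ Δ ] _≅_.to φ u ≡ v

vertexTransitive-via : ∀ {Δ} (v₀ : Fin (n Δ)) → (∀ u → Σ[ φ ∈ Δ ≅ Δ ] _≅_.to φ u ≡ v₀) → VertexTransitive Δ
vertexTransitive-via v₀ to-v₀ u v with to-v₀ u | to-v₀ v
... | φ , φu≡v₀ | ψ , ψv≡v₀ =
  ≅-trans φ (≅-sym ψ) , trans (cong (_≅_.from ψ) (trans φu≡v₀ (sym ψv≡v₀))) (_≅_.from-to ψ v)

IsConnSumAt-moveʳ : ∀ {Γ A B a b} → VertexTransitive B → IsConnSumAt Γ A B a b → ∀ b′ → IsConnSumAt Γ A B a b′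
IsConnSumAt-moveʳ {b = b} transitive S b′ with transitive b b′
... | φ , φb≡b′ = subst (IsConnSumAt _ _ _ _) φb≡b′ (IsConnSumAt-≅ʳ φ S)

IsConnSumAt-moveˡ : ∀ {Γ A B a b} → VertexTransitive A → IsConnSumAt Γ A B a b → ∀ a′ → IsConnSumAt Γ A B a′ b
IsConnSumAt-moveˡ transitive S a′ = IsConnSumAt-sym (IsConnSumAt-moveʳ transitive (IsConnSumAt-sym S) a′)

Bipartite-≅ : ∀ {Γ Δ} → Γ ≅ Δ → Bipartite Δ → Bipartite Γ
Bipartite-≅ φ (κ , proper) = κ ∘ to , λ c v e → proper c (to v) (trans (cong κ (sym (hom c v))) e)
  where open _≅_ φ

no-three-distinct-Bools : ∀ (x y z : Bool) → x ≢ y → y ≢ z → z ≢ x → ⊥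
no-three-distinct-Bools false false _     x≢y _   _   = x≢y refl
no-three-distinct-Bools true  true  _     x≢y _   _   = x≢y refl
no-three-distinct-Bools false true  false _   _   z≢x = z≢x refl
no-three-distinct-Bools false true  true  _   y≢z _   = y≢z refl
no-three-distinct-Bools true  false false _   y≢z _   = y≢z refl
no-three-distinct-Bools true  false true  _   _   z≢x = z≢x refl

-- The triangle 1, 2, 3 of 𝒫₁ avoids the vertex 0, so it survives in the sum.
𝒫₁#₀-nonbipartite : ∀ {Γ B b} → IsConnSumAt Γ 𝒫₁ B 0F b → ¬ Bipartite Γ
𝒫₁#₀-nonbipartite S (κ , proper) =
  no-three-distinct-Bools (κ (ι₁ 1F)) (κ (ι₁ 2F)) (κ (ι₁ 3F))
    (≢-sym (endpoints-differ c2 1F (λ ()) (λ ()))) (≢-sym (endpoints-differ c0 2F (λ ()) (λ ())))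
    (endpoints-differ c1 1F (λ ()) (λ ()))
  where
  open IsConnSumAt S using (ι₁; edge₁)
  endpoints-differ : ∀ c α → α ≢ 0F → σ 𝒫₁ c α ≢ 0F → κ (ι₁ (σ 𝒫₁ c α)) ≢ κ (ι₁ α)
  endpoints-differ c α α≢0 σα≢0 = subst (λ u → κ u ≢ κ (ι₁ α)) (edge₁ c α α≢0 σα≢0) (proper c (ι₁ α))

dipole : CG
dipole = record
  { n = 2 ; σ = λ _ → other
  ; invol = λ _ → from-yes (all? λ v → other (other v) ≟ v)
  ; loopless = λ _ → from-yes (all? λ v → ¬? (other v ≟ v)) }
  where
  other : Fin 2 → Fin 2
  other = opposite

𝒫₁-#-dipole : IsConnSumAt 𝒫₁ 𝒫₁ dipole 0F 0F
𝒫₁-#-dipole = record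
  { ι₁ = λ v → v ; ι₂ = λ _ → 0F
  ; inj₁ = λ _ _ _ _ e → e
  ; inj₂ = from-yes (all? λ (u : Fin 2) → all? λ v → ¬? (u ≟ 0F) →-dec ¬? (v ≟ 0F) →-dec yes refl →-dec (u ≟ v))
  ; disj = λ _ _ α≢0 _ → α≢0
  ; cover = cover
  ; edge₁ = λ _ _ _ _ → refl
  ; edge₂ = from-yes (all? λ c → all? λ v → ¬? (v ≟ 0F) →-dec ¬? (σ dipole c v ≟ 0F) →-dec (σ 𝒫₁ c 0F ≟ 0F))
  ; new = λ c → invol 𝒫₁ c 0F }
  where
  cover : ∀ v → (Σ[ α ∈ Fin 4 ] (α ≢ 0F × α ≡ v)) ⊎ (Σ[ β ∈ Fin 2 ] (β ≢ 0F × 0F ≡ v))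
  cover 0F = inj₂ (1F , (λ ()) , refl)
  cover 1F = inj₁ (1F , (λ ()) , refl)
  cover 2F = inj₁ (2F , (λ ()) , refl)
  cover 3F = inj₁ (3F , (λ ()) , refl)

-- The colour involutions of 𝒫₁ commute with each other, so each of them is an automorphism.
𝒫₁-colourAutomorphism : Color → 𝒫₁ ≅ 𝒫₁
𝒫₁-colourAutomorphism d = record
  { to = σ 𝒫₁ d ; from = σ 𝒫₁ d ; from-to = invol 𝒫₁ d ; to-from = invol 𝒫₁ d
  ; hom = from-yes (all? λ d → all? λ c → all? λ v → σ 𝒫₁ d (σ 𝒫₁ c v) ≟ σ 𝒫₁ c (σ 𝒫₁ d v)) d }

𝒫₁-vertexTransitive : VertexTransitive 𝒫₁
𝒫₁-vertexTransitive = vertexTransitive-via 0F to-0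
  where
  to-0 : ∀ u → Σ[ φ ∈ 𝒫₁ ≅ 𝒫₁ ] _≅_.to φ u ≡ 0F
  to-0 0F = ≅-refl , refl
  to-0 1F = 𝒫₁-colourAutomorphism c0 , refl
  to-0 2F = 𝒫₁-colourAutomorphism c1 , refl
  to-0 3F = 𝒫₁-colourAutomorphism c2 , refl

-- Row s sends s to 0: it is v ↦ v − s for even s (a rotation) and v ↦ s − v for odd s (a reflection), mod 6.
𝒯₁-to-0 𝒯₁-from-0 : Vec (Vec (Fin 6) 6) 6
𝒯₁-to-0 =
  (# 0 ∷ # 1 ∷ # 2 ∷ # 3 ∷ # 4 ∷ # 5 ∷ []) ∷ (# 1 ∷ # 0 ∷ # 5 ∷ # 4 ∷ # 3 ∷ # 2 ∷ []) ∷
  (# 4 ∷ # 5 ∷ # 0 ∷ # 1 ∷ # 2 ∷ # 3 ∷ []) ∷ (# 3 ∷ # 2 ∷ # 1 ∷ # 0 ∷ # 5 ∷ # 4 ∷ []) ∷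
  (# 2 ∷ # 3 ∷ # 4 ∷ # 5 ∷ # 0 ∷ # 1 ∷ []) ∷ (# 5 ∷ # 4 ∷ # 3 ∷ # 2 ∷ # 1 ∷ # 0 ∷ []) ∷ []
𝒯₁-from-0 =
  (# 0 ∷ # 1 ∷ # 2 ∷ # 3 ∷ # 4 ∷ # 5 ∷ []) ∷ (# 1 ∷ # 0 ∷ # 5 ∷ # 4 ∷ # 3 ∷ # 2 ∷ []) ∷
  (# 2 ∷ # 3 ∷ # 4 ∷ # 5 ∷ # 0 ∷ # 1 ∷ []) ∷ (# 3 ∷ # 2 ∷ # 1 ∷ # 0 ∷ # 5 ∷ # 4 ∷ []) ∷
  (# 4 ∷ # 5 ∷ # 0 ∷ # 1 ∷ # 2 ∷ # 3 ∷ []) ∷ (# 5 ∷ # 4 ∷ # 3 ∷ # 2 ∷ # 1 ∷ # 0 ∷ []) ∷ []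

𝒯₁-vertexTransitive : VertexTransitive 𝒯₁
𝒯₁-vertexTransitive = vertexTransitive-via 0F λ s → automorphism s , from-yes (all? λ s → to s s ≟ 0F) s
  where
  to from : Fin 6 → Fin 6 → Fin 6
  to s = lookup (lookup 𝒯₁-to-0 s)
  from s = lookup (lookup 𝒯₁-from-0 s)
  automorphism : Fin 6 → 𝒯₁ ≅ 𝒯₁
  automorphism s = record
    { to = to s ; from = from s
    ; from-to = from-yes (all? λ s → all? λ v → from s (to s v) ≟ v) s
    ; to-from = from-yes (all? λ s → all? λ v → to s (from s v) ≟ v) s
    ; hom = from-yes (all? λ s → all? λ c → all? λ v → to s (σ 𝒯₁ c v) ≟ σ 𝒯₁ c (to s v)) s }

𝒫₁#-nonbipartite : ∀ {Γ B p b} → IsConnSumAt Γ 𝒫₁ B p b → ¬ Bipartite Γ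
𝒫₁#-nonbipartite S = 𝒫₁#₀-nonbipartite (IsConnSumAt-moveˡ 𝒫₁-vertexTransitive S 0F)

𝒫₁-nonbipartite : ¬ Bipartite 𝒫₁
𝒫₁-nonbipartite = 𝒫₁#-nonbipartite 𝒫₁-#-dipole

𝒫-nonbipartite : ∀ {k A} → Is𝒫 (suc k) A → ¬ Bipartite A
𝒫-nonbipartite {zero} A≅𝒫₁ = 𝒫₁-nonbipartite ∘ Bipartite-≅ (≅-sym A≅𝒫₁)
𝒫-nonbipartite {suc k} (_ , _ , _ , _ , A=A₀#𝒫₁ , _) = 𝒫₁#-nonbipartite (IsConnSumAt-sym A=A₀#𝒫₁)

𝒫₁#-≅ : ∀ {Γ B p b} → IsConnSumAt Γ 𝒫₁ B p b → Γ ≅ 𝒫₁ #⟨ 0F ∣ b ⟩ B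
𝒫₁#-≅ S = IsConnSumAt-unique (IsConnSumAt-moveˡ 𝒫₁-vertexTransitive S 0F) (#-isConnSumAt _ _ _ _)

-- The normal form of the sums 𝒫ₖ # X.
𝒫₁-chain : ℕ → (X : CG) → Fin (n X) → CG
𝒫₁-chain zero    X x = X
𝒫₁-chain (suc k) X x = 𝒫₁-chain k (𝒫₁ #⟨ 0F ∣ x ⟩ X) (ConnectedSum.ι₁ 𝒫₁ 0F X x 1F)

𝒫-sum∼𝒫₁-chain : ∀ {k A} → Is𝒫 (suc k) A → ∀ {Γ X a x} → IsConnSumAt Γ A X a x →
                 ∀ x₀ → Γ ∼𝒟 𝒫₁-chain (suc k) X x₀
𝒫-sum∼𝒫₁-chain {zero} A≅𝒫₁ S x₀ = interchange (IsConnSumAt-≅ˡ A≅𝒫₁ S) (inj₁ 𝒫₁-nonbipartite) 0F x₀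
𝒫-sum∼𝒫₁-chain {suc k} {A} A-is𝒫@(A₀ , A₀-is𝒫 , a₀ , p , A=A₀#𝒫₁ , _) {Γ} {X} S x₀ = begin
  Γ                           ≈⟨ interchange S (inj₁ (𝒫-nonbipartite A-is𝒫)) (A.ι₂ p′) x₀ ⟩
  A #⟨ A.ι₂ p′ ∣ x₀ ⟩ X       ≈⟨ 𝒫-sum∼𝒫₁-chain A₀-is𝒫 A₀#[𝒫₁#X] (ConnectedSum.ι₁ 𝒫₁ 0F X x₀ 1F) ⟩
  𝒫₁-chain (suc (suc k)) X x₀ ∎
  where
  open ∼𝒟-Reasoning
  module A = IsConnSumAt A=A₀#𝒫₁
  p′ : Fin 4
  p′ = σ 𝒫₁ c0 p
  A₀#[𝒫₁#X] : IsConnSumAt (A #⟨ A.ι₂ p′ ∣ x₀ ⟩ X) A₀ (𝒫₁ #⟨ 0F ∣ x₀ ⟩ X) a₀ _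
  A₀#[𝒫₁#X] = IsConnSumAt-≅ʳ (𝒫₁#-≅ (#-isConnSumAt 𝒫₁ p′ X x₀))
                (#-assocʳ (#-isConnSumAt A _ X x₀) A=A₀#𝒫₁ (loopless 𝒫₁ c0 p) refl (#-isConnSumAt 𝒫₁ p′ X x₀))

𝒫ˡ : ℕ → CG
𝒫ˡ-vertex : ∀ k → Fin (n (𝒫ˡ k))

𝒫ˡ zero    = 𝒫₁
𝒫ˡ (suc k) = 𝒫ˡ k #⟨ 𝒫ˡ-vertex k ∣ 0F ⟩ 𝒫₁

𝒫ˡ-vertex zero    = 0F
𝒫ˡ-vertex (suc k) = ConnectedSum.ι₂ (𝒫ˡ k) (𝒫ˡ-vertex k) 𝒫₁ 0F 1F

𝒫ˡ-is𝒫 : ∀ k → Is𝒫 (suc k) (𝒫ˡ k)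
𝒫ˡ-is𝒫 zero    = ≅-refl
𝒫ˡ-is𝒫 (suc k) = 𝒫ˡ k , 𝒫ˡ-is𝒫 k , 𝒫ˡ-vertex k , 0F , #-isConnSumAt _ _ _ _ , inj₂ (inj₁ 𝒫₁-nonbipartite)

𝒫₁-chain-absorb : ∀ k {M V v} → IsConnSumAt M 𝒫₁ V 0F v → ∀ m v₀ → 𝒫₁-chain k M m ∼𝒟 𝒫₁-chain (suc k) V v₀
𝒫₁-chain-absorb zero    M=𝒫₁#V _ v₀ = interchange M=𝒫₁#V (inj₁ 𝒫₁-nonbipartite) 0F v₀
𝒫₁-chain-absorb (suc j) {M} {V} {v} M=𝒫₁#V m v₀ = begin
  𝒫₁-chain (suc j) M m                   ≈⟨ 𝒫-sum∼𝒫₁-chain (𝒫ˡ-is𝒫 j) (#-isConnSumAt (𝒫ˡ j) _ M m₁) m ⟨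
  𝒫ˡ j #⟨ 𝒫ˡ-vertex j ∣ m₁ ⟩ M           ≈⟨ 𝒫-sum∼𝒫₁-chain 𝒫ˡ#𝒫₁-is𝒫 [𝒫ˡ#𝒫₁]#V v₀ ⟩
  𝒫₁-chain (suc (suc j)) V v₀            ∎
  where
  open ∼𝒟-Reasoning
  m₁ : Fin (n M)
  m₁ = IsConnSumAt.ι₁ M=𝒫₁#V 1F
  𝒫ˡ#𝒫₁-is𝒫 : Is𝒫 (suc (suc j)) (𝒫ˡ j #⟨ 𝒫ˡ-vertex j ∣ 1F ⟩ 𝒫₁)
  𝒫ˡ#𝒫₁-is𝒫 = 𝒫ˡ j , 𝒫ˡ-is𝒫 j , 𝒫ˡ-vertex j , 1F , #-isConnSumAt _ _ _ _ , inj₂ (inj₁ 𝒫₁-nonbipartite)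
  [𝒫ˡ#𝒫₁]#V : IsConnSumAt (𝒫ˡ j #⟨ 𝒫ˡ-vertex j ∣ m₁ ⟩ M) (𝒫ˡ j #⟨ 𝒫ˡ-vertex j ∣ 1F ⟩ 𝒫₁) V _ v
  [𝒫ˡ#𝒫₁]#V = #-assocˡ (#-isConnSumAt _ _ M m₁) M=𝒫₁#V (λ ()) refl (#-isConnSumAt (𝒫ˡ j) (𝒫ˡ-vertex j) 𝒫₁ 1F)

-- The move 𝒯₁ # 𝒫₁ ⇝ 𝒫₃

module _ {Γ Γ̂ : CG} {z₁ z₂ : Fin (n Γ̂)} (ι : Fin (n Γ) → Fin (n Γ̂)) (side : Fin (n Γ̂) → Bool) where

  simpleCut-by-computation :
    {z₁≢z₂ : True (¬? (z₁ ≟ z₂))} {z-edge : True (σ Γ̂ c2 z₁ ≟ z₂)}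
    {ι-inj : True (all? λ a → all? λ b → (ι a ≟ ι b) →-dec (a ≟ b))}
    {ι≢z₁ : True (all? λ a → ¬? (ι a ≟ z₁))} {ι≢z₂ : True (all? λ a → ¬? (ι a ≟ z₂))}
    {ι-cover : True (all? λ x → ¬? (x ≟ z₁) →-dec ¬? (x ≟ z₂) →-dec any? λ a → ι a ≟ x)}
    {col2 : True (all? λ a → σ Γ̂ c2 (ι a) ≟ ι (σ Γ c2 a))}
    {col01 : True (all? λ c → ¬? (c ≟ c2) →-dec all? λ a →
               (¬? (σ Γ̂ c (ι a) ≟ z₁) →-dec ¬? (σ Γ̂ c (ι a) ≟ z₂) →-dec σ Γ̂ c (ι a) ≟ ι (σ Γ c a))
               ×-dec ((σ Γ̂ c (ι a) ≟ z₁) →-dec ι (σ Γ c a) ≟ σ Γ̂ c z₂)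
               ×-dec ((σ Γ̂ c (ι a) ≟ z₂) →-dec ι (σ Γ c a) ≟ σ Γ̂ c z₁))}
    {side-z₁ : True (side z₁ Bool.≟ false)} {side-z₂ : True (side z₂ Bool.≟ true)}
    {side-01 : True (all? λ c → ¬? (c ≟ c2) →-dec all? λ x → side (σ Γ̂ c x) Bool.≟ side x)} →
    SimpleCut Γ Γ̂ z₁ z₂
  simpleCut-by-computation {z₁≢z₂} {z-edge} {ι-inj} {ι≢z₁} {ι≢z₂} {ι-cover} {col2} {col01}
                           {side-z₁} {side-z₂} {side-01} = record
    { z₁≢z₂ = toWitness z₁≢z₂ ; z-edge = toWitness z-edge
    ; ι = ι ; ι-inj = toWitness ι-inj ; ι≢z₁ = toWitness ι≢z₁ ; ι≢z₂ = toWitness ι≢z₂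
    ; ι-cover = toWitness ι-cover ; col2 = toWitness col2 ; col01 = toWitness col01
    ; side = side ; side-z₁ = toWitness side-z₁ ; side-z₂ = toWitness side-z₂ ; side-01 = toWitness side-01 }

𝒯₁#𝒫₁ : CG
𝒯₁#𝒫₁ = 𝒯₁ #⟨ 3F ∣ 1F ⟩ 𝒫₁

𝒫₃ : CG
𝒫₃ = 𝒫₁ #⟨ 0F ∣ ConnectedSum.ι₁ 𝒫₁ 0F 𝒫₁ 2F 1F ⟩ (𝒫₁ #⟨ 0F ∣ 2F ⟩ 𝒫₁)

𝒫₃-end : Fin (n 𝒫₃)
𝒫₃-end = ConnectedSum.ι₂ 𝒫₁ 0F (𝒫₁ #⟨ 0F ∣ 2F ⟩ 𝒫₁) (ConnectedSum.ι₁ 𝒫₁ 0F 𝒫₁ 2F 1F)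
                         (ConnectedSum.ι₂ 𝒫₁ 0F 𝒫₁ 2F 0F)

-- Row c lists σ c.  Vertices 0–7 are those of 𝒯₁#𝒫₁, and 8, 9 the two new vertices of its cut.
commonCut-σ : Vec (Vec (Fin 10) 10) 3
commonCut-σ =
  (# 8 ∷ # 9 ∷ # 5 ∷ # 4 ∷ # 3 ∷ # 2 ∷ # 7 ∷ # 6 ∷ # 0 ∷ # 1 ∷ []) ∷
  (# 4 ∷ # 2 ∷ # 1 ∷ # 7 ∷ # 0 ∷ # 9 ∷ # 8 ∷ # 3 ∷ # 6 ∷ # 5 ∷ []) ∷
  (# 6 ∷ # 3 ∷ # 4 ∷ # 1 ∷ # 2 ∷ # 7 ∷ # 0 ∷ # 5 ∷ # 9 ∷ # 8 ∷ []) ∷ []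

commonCut : CG
commonCut = record
  { n = 10 ; σ = σ̂
  ; invol = from-yes (all? λ c → all? λ v → σ̂ c (σ̂ c v) ≟ v)
  ; loopless = from-yes (all? λ c → all? λ v → ¬? (σ̂ c v ≟ v)) }
  where
  σ̂ : Color → Fin 10 → Fin 10
  σ̂ c = lookup (lookup commonCut-σ c)

cut-𝒯₁#𝒫₁ : SimpleCut 𝒯₁#𝒫₁ commonCut (# 8) (# 9)
cut-𝒯₁#𝒫₁ = simpleCut-by-computation (_↑ˡ 2)
  (lookup (false ∷ true ∷ true ∷ false ∷ false ∷ true ∷ false ∷ false ∷ false ∷ true ∷ []))

cut-𝒫₃ : SimpleCut 𝒫₃ commonCut (# 1) (# 3)
cut-𝒫₃ = simpleCut-by-computation (lookup (# 6 ∷ # 0 ∷ # 8 ∷ # 9 ∷ # 4 ∷ # 5 ∷ # 2 ∷ # 7 ∷ []))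
  (lookup (true ∷ false ∷ false ∷ true ∷ true ∷ false ∷ true ∷ true ∷ true ∷ false ∷ []))

𝒯₁#𝒫₁⇝𝒫₃ : CutAndGlueAt 𝒯₁#𝒫₁ (ConnectedSum.ι₂ 𝒯₁ 3F 𝒫₁ 1F 0F) 𝒫₃ 𝒫₃-end
𝒯₁#𝒫₁⇝𝒫₃ = record { cut = cut-𝒯₁#𝒫₁ ; cut′ = cut-𝒫₃ ; ι≡ι′ = refl }

module 𝒯₁#𝒫₁-Move {X X′ : CG} {x′ : Fin (n X′)} (X=𝒫₁#X′ : IsConnSumAt X 𝒫₁ X′ 0F x′) where
  module X = IsConnSumAt X=𝒫₁#X′

  𝒯₁#X : CG
  𝒯₁#X = 𝒯₁ #⟨ 3F ∣ X.ι₁ 1F ⟩ X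

  𝒯₁#X-0 : Fin (n 𝒯₁#X)
  𝒯₁#X-0 = ConnectedSum.ι₁ 𝒯₁ 3F X (X.ι₁ 1F) 0F

  X′#𝒫₃ : CG
  X′#𝒫₃ = X′ #⟨ x′ ∣ 𝒫₃-end ⟩ 𝒫₃

  X′#𝒫₃-1 : Fin (n X′#𝒫₃)
  X′#𝒫₃-1 = ConnectedSum.ι₂ X′ x′ 𝒫₃ 𝒫₃-end 1F

  𝒯₁#X=𝒯₁#𝒫₁#X′ : IsConnSumAt 𝒯₁#X 𝒯₁#𝒫₁ X′ (ConnectedSum.ι₂ 𝒯₁ 3F 𝒫₁ 1F 0F) x′
  𝒯₁#X=𝒯₁#𝒫₁#X′ = #-assocˡ (#-isConnSumAt 𝒯₁ 3F X (X.ι₁ 1F)) X=𝒫₁#X′ (λ ()) refl (#-isConnSumAt 𝒯₁ 3F 𝒫₁ 1F)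

  move : CutAndGlueAt 𝒯₁#X 𝒯₁#X-0 X′#𝒫₃ X′#𝒫₃-1
  move = subst (λ u → CutAndGlueAt 𝒯₁#X u X′#𝒫₃ X′#𝒫₃-1)
               (#-assocˡ-ι₁-ι₁ (#-isConnSumAt 𝒯₁ 3F X (X.ι₁ 1F)) X=𝒫₁#X′ (λ ()) refl (#-isConnSumAt 𝒯₁ 3F 𝒫₁ 1F)
                               0F (λ ()))
               (cutAndGlueAt-# 𝒯₁#𝒫₁⇝𝒫₃ (IsConnSumAt-sym 𝒯₁#X=𝒯₁#𝒫₁#X′) (#-isConnSumAt X′ x′ 𝒫₃ 𝒫₃-end)
                               {y = ConnectedSum.ι₁ 𝒯₁ 3F 𝒫₁ 1F 0F} {y′ = 1F} (λ ()) (λ ()) refl)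

  private
    𝒫₁#𝒫₁ : CG
    𝒫₁#𝒫₁ = 𝒫₁ #⟨ 0F ∣ 2F ⟩ 𝒫₁

    𝒫₁#𝒫₁-end : Fin (n 𝒫₁#𝒫₁)
    𝒫₁#𝒫₁-end = ConnectedSum.ι₂ 𝒫₁ 0F 𝒫₁ 2F 0F

    V : CG
    V = 𝒫₁#𝒫₁ #⟨ 𝒫₁#𝒫₁-end ∣ x′ ⟩ X′

  X′#𝒫₃=𝒫₁#V : IsConnSumAt X′#𝒫₃ 𝒫₁ V 0F _
  X′#𝒫₃=𝒫₁#V = #-assocʳ (IsConnSumAt-sym (#-isConnSumAt X′ x′ 𝒫₃ 𝒫₃-end))
                         (#-isConnSumAt 𝒫₁ 0F 𝒫₁#𝒫₁ _) (λ ()) refl (#-isConnSumAt 𝒫₁#𝒫₁ 𝒫₁#𝒫₁-end X′ x′)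

  V=𝒫₁#X : IsConnSumAt V 𝒫₁ X 0F (X.ι₁ 2F)
  V=𝒫₁#X = #-assocʳ (#-isConnSumAt 𝒫₁#𝒫₁ 𝒫₁#𝒫₁-end X′ x′) (#-isConnSumAt 𝒫₁ 0F 𝒫₁ 2F) (λ ()) refl X=𝒫₁#X′

  absorb : ∀ k m x₀ → 𝒫₁-chain k X′#𝒫₃ m ∼𝒟 𝒫₁-chain (2 + k) X x₀
  absorb k m x₀ = begin
    𝒫₁-chain k X′#𝒫₃ m     ≈⟨ 𝒫₁-chain-absorb k X′#𝒫₃=𝒫₁#V m v ⟩
    𝒫₁-chain (1 + k) V v   ≈⟨ 𝒫₁-chain-absorb (suc k) V=𝒫₁#X v x₀ ⟩
    𝒫₁-chain (2 + k) X x₀  ∎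
    where
    open ∼𝒟-Reasoning
    v : Fin (n V)
    v = IsConnSumAt.ι₁ V=𝒫₁#X 1F

𝒯-sum∼𝒫₁-chain : ∀ m {T X X′ x′} → Is𝒯 (suc m) T → IsConnSumAt X 𝒫₁ X′ 0F x′ →
                 ∀ {Γ t x} → IsConnSumAt Γ T X t x → ∀ x₀ → Γ ∼𝒟 𝒫₁-chain (2 * suc m) X x₀
𝒯-sum∼𝒫₁-chain zero {X = X} T≅𝒯₁ X=𝒫₁#X′ {Γ} S x₀ = begin
  Γ                  ≈⟨ interchange (IsConnSumAt-≅ˡ T≅𝒯₁ S) (inj₂ (𝒫₁#-nonbipartite X=𝒫₁#X′)) 3F (X.ι₁ 1F) ⟩
  𝒯₁#X               ≈⟨ cutAndGlue⇒∼𝒟 (CutAndGlueAt.cutAndGlue move) ⟩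
  X′#𝒫₃              ≈⟨ absorb 0 X′#𝒫₃-1 x₀ ⟩
  𝒫₁-chain 2 X x₀    ∎
  where
  open ∼𝒟-Reasoning
  open 𝒯₁#𝒫₁-Move X=𝒫₁#X′
𝒯-sum∼𝒫₁-chain (suc m) {T} {X} (T₀ , T₀-is𝒯 , t₀ , _ , T=T₀#𝒯₁ , _) X=𝒫₁#X′ {Γ} S x₀ = begin
  Γ                                     ≈⟨ interchange S (inj₂ (𝒫₁#-nonbipartite X=𝒫₁#X′)) t₃ (X.ι₁ 1F) ⟩
  T #⟨ t₃ ∣ X.ι₁ 1F ⟩ X                 ≈⟨ cutAndGlue⇒∼𝒟 (cutAndGlue-# move T₀#𝒯₁#X T₀#X′#𝒫₃) ⟩
  T₀ #⟨ t₀ ∣ X′#𝒫₃-1 ⟩ X′#𝒫₃            ≈⟨ 𝒯-sum∼𝒫₁-chain m T₀-is𝒯 X′#𝒫₃=𝒫₁#V T₀#X′#𝒫₃ X′#𝒫₃-1 ⟩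
  𝒫₁-chain (2 * suc m) X′#𝒫₃ X′#𝒫₃-1    ≈⟨ absorb (2 * suc m) X′#𝒫₃-1 x₀ ⟩
  𝒫₁-chain (2 + 2 * suc m) X x₀         ≡⟨ cong (λ k → 𝒫₁-chain k X x₀) (sym (*-suc 2 (suc m))) ⟩
  𝒫₁-chain (2 * suc (suc m)) X x₀       ∎
  where
  open ∼𝒟-Reasoning
  open 𝒯₁#𝒫₁-Move X=𝒫₁#X′
  T=T₀#₀𝒯₁ : IsConnSumAt T T₀ 𝒯₁ t₀ 0F
  T=T₀#₀𝒯₁ = IsConnSumAt-moveʳ 𝒯₁-vertexTransitive T=T₀#𝒯₁ 0F
  t₃ : Fin (n T)
  t₃ = IsConnSumAt.ι₂ T=T₀#₀𝒯₁ 3F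
  T₀#𝒯₁#X : IsConnSumAt (T #⟨ t₃ ∣ X.ι₁ 1F ⟩ X) T₀ 𝒯₁#X t₀ 𝒯₁#X-0
  T₀#𝒯₁#X = #-assocʳ (#-isConnSumAt T t₃ X (X.ι₁ 1F)) T=T₀#₀𝒯₁ (λ ()) refl (#-isConnSumAt 𝒯₁ 3F X (X.ι₁ 1F))
  T₀#X′#𝒫₃ : IsConnSumAt (T₀ #⟨ t₀ ∣ X′#𝒫₃-1 ⟩ X′#𝒫₃) T₀ X′#𝒫₃ t₀ X′#𝒫₃-1
  T₀#X′#𝒫₃ = #-isConnSumAt T₀ t₀ X′#𝒫₃ X′#𝒫₃-1

lemma3p1 : (m : ℕ) → 1 ≤ m →
           (T Γ Π : CG) →
           Is𝒯 m T →
           ConnSum Γ T 𝒫₁ →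
           Is𝒫 (2 * m + 1) Π →
           Γ ∼𝒟 Π
lemma3p1 (suc m) _ T Γ Π T-is𝒯 (_ , _ , Γ=T#𝒫₁ , _) Π-is𝒫
  with subst (λ k → Is𝒫 k Π) (+-comm (2 * suc m) 1) Π-is𝒫
... | Π₀ , Π₀-is𝒫 , _ , _ , Π=Π₀#𝒫₁ , _ = begin
  Γ                           ≈⟨ 𝒯-sum∼𝒫₁-chain m T-is𝒯 𝒫₁-#-dipole Γ=T#𝒫₁ 0F ⟩
  𝒫₁-chain (2 * suc m) 𝒫₁ 0F  ≈⟨ 𝒫-sum∼𝒫₁-chain Π₀-is𝒫 Π=Π₀#𝒫₁ 0F ⟨
  Π                           ∎
  where open ∼𝒟-Reasoning
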